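{- Fix an integer $q \ge 2$. There exist constants $K > 0$ and $\varepsilon_0 > 0$ (depending only on $q$) such that for every $0 < \varepsilon \le \varepsilon_0$ there exists $n_0$ with the following property. Let $n \ge n_0$, let $t$ be a positive integer with $t \le 10\sqrt{n}$, and let $S \subseteq [q]^n$ satisfy $\Delta(G_{q,n,t}[S]) \le n^5$. Let \[ S_1 = \left\{ v \in S : \deg_k(v) \le \varepsilon\, n^{\lceil k/2 \rceil / 2} \text{ for each } k = 1, \dots, 20 \right\}. \] Then $|S_1| \le (1 + K\varepsilon) H_q(n,t)$.
   Context: $d(x,y)$ is the Hamming distance on $[q]^n$. $V_q(n,r) = \sum_{i=0}^{r} \binom{n}{i}(q-1)^i$ and $H_q(n,t) = q^n/V_q(n,t)$. $G_{q,n,t}$ is the graph on $[q]^n$ in which two distinct vertices are adjacent iff their Hamming distance is at most $2t$; $G_{q,n,t}[S]$ is the induced subgraph on $S$ and $\Delta$ denotes maximum degree. For $v \in S$, $\deg_k(v) = |\{u \in S : d(u,v) = k\}|$.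
   Formalization: The parameter ε ranges only over rationals with $0 < \varepsilon \le \varepsilon_0$, and the constants K and ε₀ are taken in ℚ. -}

module Defs where

open import Data.Nat as ℕ using (ℕ; zero; suc; _+_; _*_; _^_; _≤_; _≡ᵇ_; _≤ᵇ_; NonZero)
open import Data.Nat.Properties as ℕP using ()
open import Data.Nat.Combinatorics using (_C_)
open import Data.Bool using (Bool; true; false; _∧_; not; if_then_else_)
open import Data.Fin using (Fin; _≟_)
open import Data.Fin.Base using () renaming (toℕ to finToℕ)
open import Data.List using (List; []; _∷_; map; concatMap; length; filterᵇ; allFin; upTo)
open import Data.Vec using (Vec; []; _∷_)
open import Data.Integer using (+_)
open import Data.Rational as ℚ using (ℚ; _/_)
open import Relation.Nullary.Decidable using (⌊_⌋)
open import Relation.Binary.PropositionalEquality using (_≡_; refl)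

-- The word [q]^n is Vec (Fin q) n; all q^n words listed (each exactly once).
words : (q n : ℕ) → List (Vec (Fin q) n)
words q zero    = [] ∷ []
words q (suc n) = concatMap (λ w → map (λ a → a ∷ w) (allFin q)) (words q n)

ham : {q n : ℕ} → Vec (Fin q) n → Vec (Fin q) n → ℕ
ham []       []       = 0
ham (a ∷ x) (b ∷ y) = (if ⌊ a ≟ b ⌋ then 0 else 1) + ham x y

-- Number of words of [q]^n satisfying a Boolean predicate
-- (subsets of [q]^n are represented by their Boolean indicator).
count : (q n : ℕ) → (Vec (Fin q) n → Bool) → ℕ
count q n P = length (filterᵇ P (words q n))

Vq : (q n r : ℕ) → ℕ
Vq q n zero    = (n C 0) * (q ℕ.∸ 1) ^ 0
Vq q n (suc r) = Vq q n r + (n C (suc r)) * (q ℕ.∸ 1) ^ (suc r)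

Vq-nonZero : (q n r : ℕ) → NonZero (Vq q n r)
Vq-nonZero q n zero    = record { nonZero = _ }
Vq-nonZero q n (suc r) with Vq q n r | Vq-nonZero q n r
... | suc m | _ = record { nonZero = _ }

Hq : (q n t : ℕ) → ℚ
Hq q n t = (+ (q ^ n)) / Vq q n t
  where instance _ = Vq-nonZero q n t

-- Degree of v in G_{q,n,t}[S]: number of u ∈ S, u ≠ v, with d(u,v) ≤ 2t.
degG : (q n t : ℕ) → (Vec (Fin q) n → Bool) → Vec (Fin q) n → ℕ
degG q n t S v = count q n (λ u → S u ∧ not (ham u v ≡ᵇ 0) ∧ (ham u v ≤ᵇ 2 * t))

MaxDegLE : (q n t : ℕ) → (Vec (Fin q) n → Bool) → ℕ → Set
MaxDegLE q n t S D = (v : Vec (Fin q) n) → S v ≡ true → degG q n t S v ≤ D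

degk : (q n : ℕ) → (Vec (Fin q) n → Bool) → Vec (Fin q) n → ℕ → ℕ
degk q n S v k = count q n (λ u → S u ∧ (ham u v ≡ᵇ k))

ceilHalf : ℕ → ℕ
ceilHalf k = (k + 1) ℕ./ 2

ℕtoℚ : ℕ → ℚ
ℕtoℚ m = (+ m) / 1

-- deg ≤ ε · n^{⌈k/2⌉/2}, with deg ≥ 0 and ε > 0, encoded (equivalently, by
-- squaring both nonnegative sides) as deg² ≤ ε² · n^{⌈k/2⌉}.
degOK : ℚ → (n d k : ℕ) → Bool
degOK ε n d k = ℕtoℚ (d * d) ℚ.≤ᵇ (ε ℚ.* ε) ℚ.* ℕtoℚ (n ^ ceilHalf k)

allᵇ : List ℕ → (ℕ → Bool) → Bool
allᵇ []       f = true
allᵇ (k ∷ ks) f = f k ∧ allᵇ ks f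

S1 : (q n : ℕ) → ℚ → (Vec (Fin q) n → Bool) → Vec (Fin q) n → Bool
S1 q n ε S v = S v ∧ allᵇ (map suc (upTo 20)) (λ k → degOK ε n (degk q n S v k) k)

{-# OPTIONS --safe #-}
-- Double count the pairs (u, x) with u ∈ S₁ and d(x, u) ≤ t: a point lying in c of these balls has
-- c ≤ 1 + c(c − 1), so |S₁| V_q(n,t) ≤ q^n + Σ_{u ∈ S₁} Σ_{v ∈ S₁, v ≠ u} |B(u,t) ∩ B(v,t)|.
-- Balls whose centres are at distance d are disjoint if d > 2t, and otherwise meet in at most
-- q^d V_q(n, t − ⌈d/2⌉) ≤ q^d (2t/n)^⌈d/2⌉ V_q(n,t) points. As (2t)² ≤ 400n, the at most ε n^{⌈d/2⌉/2}
-- neighbours of u at a distance d ≤ 20 contribute O(ε V_q(n,t)), while the at most n^5 neighbours at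
-- distances 21 ≤ d ≤ 2t contribute O(n^{-1/2} V_q(n,t)), which is below ε V_q(n,t) for large n.
-- Hence |S₁| V_q(n,t) ≤ q^n + |S₁| (Kε/2) V_q(n,t), which rearranges to the claim when Kε < 1.

module Submission where

open import Defs
open import Data.Nat as ℕ using (ℕ; zero; suc; _+_; _*_; _^_; _≤_; _<_; _∸_; _≤ᵇ_; _≡ᵇ_; z≤n; s≤s; NonZero)
open import Data.Nat.Properties hiding (_≟_)
open import Data.Nat.Combinatorics using (_C_; nCk+nC[k+1]≡[n+1]C[k+1]; nC1≡n)
open import Data.Nat.DivMod using (m/n*n≤m; m≡m%n+[m/n]*n; m%n<n)
open import Data.Nat.Tactic.RingSolver using (solve-∀)
open import Data.Bool using (Bool; true; false; _∧_; not; T; if_then_else_)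
open import Data.Bool.Properties using (T-≡)
open import Data.Fin using (Fin; _≟_) renaming (zero to fzero; suc to fsuc)
open import Data.Fin.Properties using () renaming (suc-injective to fsuc-injective)
open import Data.List using (List; []; _∷_; map; concatMap; length; filterᵇ; allFin; upTo; _++_; tabulate)
open import Data.List.Membership.Propositional using (_∈_)
open import Data.List.Membership.Propositional.Properties using (∈-map⁺; ∈-upTo⁺)
open import Data.List.Relation.Unary.Any using (here; there)
open import Data.List.Relation.Unary.All as All using (All; []; _∷_)
open import Data.Vec using (Vec; []; _∷_)
open import Data.Unit using (tt)
open import Data.Empty using (⊥-elim)
open import Data.Product using (Σ; _×_; _,_)
open import Data.Sum using (inj₁; inj₂)
open import Function using (_∘_; id; Equivalence)
open import Relation.Nullary using (yes; no; ¬_)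
open import Relation.Nullary.Decidable using (⌊_⌋; toWitness)
open import Relation.Binary.PropositionalEquality
open import Data.Integer as ℤ using (-[1+_]) renaming (+_ to +ℤ_)
import Data.Integer.Properties as ℤP
open import Data.Rational as ℚ using (ℚ; mkℚ; 0ℚ; 1ℚ; toℚᵘ; fromℚᵘ)
import Data.Rational.Properties as ℚP
open import Data.Rational.Unnormalised as ℚᵘ using (mkℚᵘ; *≤*; *<*)
import Data.Rational.Unnormalised.Properties as ℚᵘP


𝟙 : Bool → ℕ
𝟙 true  = 1
𝟙 false = 0

𝟙≤1 : ∀ b → 𝟙 b ≤ 1
𝟙≤1 true  = s≤s z≤n
𝟙≤1 false = z≤n

T⇒≡true : ∀ {b} → T b → b ≡ true
T⇒≡true = Equivalence.to T-≡

≡true⇒T : ∀ {b} → b ≡ true → T b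
≡true⇒T = Equivalence.from T-≡

𝟙-≤ᵇ-mono : ∀ {a b c d} → (a ≤ b → c ≤ d) → 𝟙 (a ≤ᵇ b) ≤ 𝟙 (c ≤ᵇ d)
𝟙-≤ᵇ-mono {a} {b} {c} {d} imp with a ≤ᵇ b in ab
... | false = z≤n
... | true with c ≤ᵇ d in cd
...   | true  = s≤s z≤n
...   | false with ≤⇒≤ᵇ (imp (≤ᵇ⇒≤ a b (≡true⇒T ab)))
...     | c≤ᵇd rewrite cd = ⊥-elim c≤ᵇd

𝟙-≤ᵇ-false : ∀ {a b} → ¬ a ≤ b → 𝟙 (a ≤ᵇ b) ≡ 0
𝟙-≤ᵇ-false {a} {b} a≰b with a ≤ᵇ b in ab
... | false = refl
... | true  = ⊥-elim (a≰b (≤ᵇ⇒≤ a b (≡true⇒T ab)))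

𝟙-≤ᵇ-true : ∀ {a b} → a ≤ b → 𝟙 (a ≤ᵇ b) ≡ 1
𝟙-≤ᵇ-true a≤b rewrite T⇒≡true (≤⇒≤ᵇ a≤b) = refl

allᵇ⇒All : ∀ (L : List ℕ) f → allᵇ L f ≡ true → All (λ k → f k ≡ true) L
allᵇ⇒All []      f _  = []
allᵇ⇒All (k ∷ L) f ok with f k in fk
... | true = fk ∷ allᵇ⇒All L f ok

∧≡true⇒ˡ : ∀ {x y} → (x ∧ y) ≡ true → x ≡ true
∧≡true⇒ˡ {true} _ = refl

∧≡true⇒ʳ : ∀ {x y} → (x ∧ y) ≡ true → y ≡ true
∧≡true⇒ʳ {true} y = y

∑ : {A : Set} → List A → (A → ℕ) → ℕ
∑ []       f = 0
∑ (x ∷ xs) f = f x + ∑ xs f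

syntax ∑ L (λ x → e) = ∑[ x ∈ L ] e

module _ {A : Set} where

  ∑-mono-≤ : (L : List A) {f g : A → ℕ} → (∀ x → f x ≤ g x) → ∑ L f ≤ ∑ L g
  ∑-mono-≤ []      f≤g = z≤n
  ∑-mono-≤ (x ∷ L) f≤g = +-mono-≤ (f≤g x) (∑-mono-≤ L f≤g)

  ∑-cong : (L : List A) {f g : A → ℕ} → (∀ x → f x ≡ g x) → ∑ L f ≡ ∑ L g
  ∑-cong []      f≡g = refl
  ∑-cong (x ∷ L) f≡g = cong₂ _+_ (f≡g x) (∑-cong L f≡g)

  ∑-+ : (L : List A) (f g : A → ℕ) → ∑[ x ∈ L ] (f x + g x) ≡ ∑ L f + ∑ L g
  ∑-+ []      f g = refl
  ∑-+ (x ∷ L) f g rewrite ∑-+ L f g = +-+-+ (f x) (g x) (∑ L f) (∑ L g)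
    where
    +-+-+ : ∀ a b c d → a + b + (c + d) ≡ a + c + (b + d)
    +-+-+ = solve-∀

  ∑-*ˡ : (L : List A) (c : ℕ) (f : A → ℕ) → ∑[ x ∈ L ] (c * f x) ≡ c * ∑ L f
  ∑-*ˡ []      c f = sym (*-zeroʳ c)
  ∑-*ˡ (x ∷ L) c f rewrite ∑-*ˡ L c f = sym (*-distribˡ-+ c (f x) (∑ L f))

  ∑-const : (L : List A) (c : ℕ) → ∑[ _ ∈ L ] c ≡ length L * c
  ∑-const []      c = refl
  ∑-const (x ∷ L) c = cong (c +_) (∑-const L c)

  ∑-zero : (L : List A) {f : A → ℕ} → (∀ x → f x ≡ 0) → ∑ L f ≡ 0
  ∑-zero L f≡0 = trans (∑-cong L f≡0) (trans (∑-const L 0) (*-zeroʳ (length L)))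

  ∑-++ : (L M : List A) (f : A → ℕ) → ∑ (L ++ M) f ≡ ∑ L f + ∑ M f
  ∑-++ []      M f = refl
  ∑-++ (x ∷ L) M f rewrite ∑-++ L M f = sym (+-assoc (f x) _ _)

  ∑-≤-const : (L : List A) (c : ℕ) {f : A → ℕ} → All (λ x → f x ≤ c) L → ∑ L f ≤ length L * c
  ∑-≤-const []      c []         = z≤n
  ∑-≤-const (x ∷ L) c (fx≤c ∷ h) = +-mono-≤ fx≤c (∑-≤-const L c h)

  term≤∑ : (L : List A) (f : A → ℕ) {x : A} → x ∈ L → f x ≤ ∑ L f
  term≤∑ (y ∷ L) f (here refl) = m≤m+n _ _
  term≤∑ (y ∷ L) f (there x∈L) = ≤-trans (term≤∑ L f x∈L) (m≤n+m _ _)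

  length-filterᵇ : (P : A → Bool) (L : List A) → length (filterᵇ P L) ≡ ∑[ x ∈ L ] 𝟙 (P x)
  length-filterᵇ P []      = refl
  length-filterᵇ P (x ∷ L) with P x
  ... | true  = cong suc (length-filterᵇ P L)
  ... | false = length-filterᵇ P L

∑-map : {A B : Set} (L : List A) (g : A → B) (f : B → ℕ) → ∑ (map g L) f ≡ ∑ L (f ∘ g)
∑-map []      g f = refl
∑-map (x ∷ L) g f = cong (f (g x) +_) (∑-map L g f)

∑-concatMap : {A B : Set} (L : List A) (g : A → List B) (f : B → ℕ) →
  ∑ (concatMap g L) f ≡ ∑[ x ∈ L ] ∑ (g x) f
∑-concatMap []      g f = refl
∑-concatMap (x ∷ L) g f = trans (∑-++ (g x) (concatMap g L) f) (cong (∑ (g x) f +_) (∑-concatMap L g f))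

∑-comm : {A B : Set} (L : List A) (M : List B) (f : A → B → ℕ) →
  ∑[ x ∈ L ] ∑[ y ∈ M ] f x y ≡ ∑[ y ∈ M ] ∑[ x ∈ L ] f x y
∑-comm []      M f = sym (∑-zero M (λ _ → refl))
∑-comm (x ∷ L) M f rewrite ∑-comm L M f = sym (∑-+ M (f x) (λ y → ∑[ x ∈ L ] f x y))

∑Fin : (q : ℕ) → (Fin q → ℕ) → ℕ
∑Fin zero    f = 0
∑Fin (suc q) f = f fzero + ∑Fin q (f ∘ fsuc)

∑-tabulate : {A : Set} (q : ℕ) (g : Fin q → A) (f : A → ℕ) → ∑ (tabulate g) f ≡ ∑Fin q (f ∘ g)
∑-tabulate zero    g f = refl
∑-tabulate (suc q) g f = cong (f (g fzero) +_) (∑-tabulate q (g ∘ fsuc) f)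

∑Fin-cong : (q : ℕ) {f g : Fin q → ℕ} → (∀ a → f a ≡ g a) → ∑Fin q f ≡ ∑Fin q g
∑Fin-cong zero    f≡g = refl
∑Fin-cong (suc q) f≡g = cong₂ _+_ (f≡g fzero) (∑Fin-cong q (f≡g ∘ fsuc))

∑Fin-const : (q c : ℕ) → ∑Fin q (λ _ → c) ≡ q * c
∑Fin-const zero    c = refl
∑Fin-const (suc q) c = cong (c +_) (∑Fin-const q c)

∑Fin-≤-const : (q c : ℕ) {f : Fin q → ℕ} → (∀ a → f a ≤ c) → ∑Fin q f ≤ q * c
∑Fin-≤-const zero    c f≤c = z≤n
∑Fin-≤-const (suc q) c f≤c = +-mono-≤ (f≤c fzero) (∑Fin-≤-const q c (f≤c ∘ fsuc))

private
  swap-+ : ∀ x y z → y + (x + z) ≡ x + (y + z)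
  swap-+ = solve-∀

  ≢-fsuc : ∀ {q} {a b : Fin q} → ¬ a ≡ b → ¬ fsuc a ≡ fsuc b
  ≢-fsuc a≢b = a≢b ∘ fsuc-injective

∑Fin-single-≡ : (q : ℕ) (b : Fin q) (X Y : ℕ) {f : Fin q → ℕ} →
  f b ≡ X → (∀ a → ¬ a ≡ b → f a ≡ Y) → ∑Fin q f ≡ X + (q ∸ 1) * Y
∑Fin-single-≡ (suc q) fzero X Y fb fa =
  cong₂ _+_ fb (trans (∑Fin-cong q (λ a → fa (fsuc a) (λ ()))) (∑Fin-const q Y))
∑Fin-single-≡ (suc (suc q)) (fsuc b) X Y fb fa =
  trans (cong₂ _+_ (fa fzero (λ ())) (∑Fin-single-≡ (suc q) b X Y fb (λ a → fa (fsuc a) ∘ ≢-fsuc)))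
        (swap-+ X Y (q * Y))

∑Fin-single-≤ : (q : ℕ) (b : Fin q) (X Y : ℕ) {f : Fin q → ℕ} →
  f b ≤ X → (∀ a → ¬ a ≡ b → f a ≤ Y) → ∑Fin q f ≤ X + (q ∸ 1) * Y
∑Fin-single-≤ (suc q) fzero X Y fb fa = +-mono-≤ fb (∑Fin-≤-const q Y (λ a → fa (fsuc a) (λ ())))
∑Fin-single-≤ (suc (suc q)) (fsuc b) X Y fb fa =
  ≤-trans (+-mono-≤ (fa fzero (λ ())) (∑Fin-single-≤ (suc q) b X Y fb (λ a → fa (fsuc a) ∘ ≢-fsuc)))
          (≤-reflexive (swap-+ X Y (q * Y)))

mismatch : {q : ℕ} → Fin q → Fin q → ℕ
mismatch a b = if ⌊ a ≟ b ⌋ then 0 else 1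

mismatch-refl : {q : ℕ} (a : Fin q) → mismatch a a ≡ 0
mismatch-refl a with a ≟ a
... | yes _   = refl
... | no a≢a = ⊥-elim (a≢a refl)

mismatch-≢ : {q : ℕ} {a b : Fin q} → ¬ a ≡ b → mismatch a b ≡ 1
mismatch-≢ {a = a} {b} a≢b with a ≟ b
... | yes a≡b = ⊥-elim (a≢b a≡b)
... | no _    = refl

mismatch-sym : {q : ℕ} (a b : Fin q) → mismatch a b ≡ mismatch b a
mismatch-sym a b with a ≟ b | b ≟ a
... | yes _   | yes _   = refl
... | no _    | no _    = refl
... | yes a≡b | no b≢a = ⊥-elim (b≢a (sym a≡b))
... | no a≢b | yes b≡a = ⊥-elim (a≢b (sym b≡a))

mismatch-triangle : {q : ℕ} (a b c : Fin q) → mismatch b c ≤ mismatch a b + mismatch a c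
mismatch-triangle a b c with a ≟ b | a ≟ c | b ≟ c
... | _        | _        | yes _   = z≤n
... | yes refl | yes refl | no b≢b = ⊥-elim (b≢b refl)
... | yes _    | no _     | no _    = s≤s z≤n
... | no _     | _        | no _    = s≤s z≤n

ham-sym : {q n : ℕ} (x y : Vec (Fin q) n) → ham x y ≡ ham y x
ham-sym []      []      = refl
ham-sym (a ∷ x) (b ∷ y) = cong₂ _+_ (mismatch-sym a b) (ham-sym x y)

ham-triangle : {q n : ℕ} (x u v : Vec (Fin q) n) → ham u v ≤ ham x u + ham x v
ham-triangle []      []      []      = z≤n
ham-triangle (a ∷ x) (b ∷ u) (c ∷ v) =
  ≤-trans (+-mono-≤ (mismatch-triangle a b c) (ham-triangle x u v))
          (≤-reflexive (+-+-+ (mismatch a b) (mismatch a c) (ham x u) (ham x v)))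
  where
  +-+-+ : ∀ a b c d → a + b + (c + d) ≡ a + c + (b + d)
  +-+-+ = solve-∀

count≡∑ : (q n : ℕ) (P : Vec (Fin q) n → Bool) → count q n P ≡ ∑[ x ∈ words q n ] 𝟙 (P x)
count≡∑ q n P = length-filterᵇ P (words q n)

∑-words-suc : (q n : ℕ) (f : Vec (Fin q) (suc n) → ℕ) →
  ∑ (words q (suc n)) f ≡ ∑Fin q (λ a → ∑[ w ∈ words q n ] f (a ∷ w))
∑-words-suc q n f = begin
  ∑ (words q (suc n)) f
    ≡⟨ ∑-concatMap (words q n) (λ w → map (_∷ w) (allFin q)) f ⟩
  ∑[ w ∈ words q n ] ∑ (map (_∷ w) (allFin q)) f
    ≡⟨ ∑-cong (words q n) (λ w → ∑-map (allFin q) (_∷ w) f) ⟩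
  ∑[ w ∈ words q n ] ∑[ a ∈ allFin q ] f (a ∷ w)
    ≡⟨ ∑-comm (words q n) (allFin q) (λ w a → f (a ∷ w)) ⟩
  ∑[ a ∈ allFin q ] ∑[ w ∈ words q n ] f (a ∷ w)
    ≡⟨ ∑-tabulate q id _ ⟩
  ∑Fin q (λ a → ∑[ w ∈ words q n ] f (a ∷ w)) ∎
  where open ≡-Reasoning

∑-words-1 : (q n : ℕ) → ∑[ _ ∈ words q n ] 1 ≡ q ^ n
∑-words-1 q zero    = refl
∑-words-1 q (suc n) = begin
  ∑[ _ ∈ words q (suc n) ] 1         ≡⟨ ∑-words-suc q n (λ _ → 1) ⟩
  ∑Fin q (λ _ → ∑[ _ ∈ words q n ] 1) ≡⟨ ∑Fin-cong q (λ _ → ∑-words-1 q n) ⟩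
  ∑Fin q (λ _ → q ^ n)                ≡⟨ ∑Fin-const q (q ^ n) ⟩
  q * q ^ n                           ∎
  where open ≡-Reasoning

Vq-pascal : (q n r : ℕ) → Vq q (suc n) (suc r) ≡ Vq q n (suc r) + (q ∸ 1) * Vq q n r
Vq-pascal q n zero rewrite sym (nCk+nC[k+1]≡[n+1]C[k+1] n 0) = rearrange (n C 1) (q ∸ 1)
  where
  rearrange : ∀ c p → 1 + (1 + c) * (p * 1) ≡ 1 + c * (p * 1) + p * 1
  rearrange = solve-∀
Vq-pascal q n (suc r) rewrite Vq-pascal q n r | sym (nCk+nC[k+1]≡[n+1]C[k+1] n (suc r)) =
  rearrange (Vq q n r) (n C suc r) (n C suc (suc r)) (q ∸ 1) ((q ∸ 1) ^ r)
  where
  rearrange : ∀ V c d p P → V + c * (p * P) + p * V + (c + d) * (p * (p * P))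
                          ≡ V + c * (p * P) + d * (p * (p * P)) + p * (V + c * (p * P))
  rearrange = solve-∀

Vq-mono-n : (q n r : ℕ) → Vq q n r ≤ Vq q (suc n) r
Vq-mono-n q n zero    = ≤-refl
Vq-mono-n q n (suc r) rewrite Vq-pascal q n r = m≤m+n _ _

Vq≥1 : (q n r : ℕ) → 1 ≤ Vq q n r
Vq≥1 q n zero    = s≤s z≤n
Vq≥1 q n (suc r) = ≤-trans (Vq≥1 q n r) (m≤m+n _ _)

suc-≤ᵇ-suc : ∀ m n → (suc m ≤ᵇ suc n) ≡ (m ≤ᵇ n)
suc-≤ᵇ-suc zero    n = refl
suc-≤ᵇ-suc (suc m) n = refl

ball-volume : (q n : ℕ) (u : Vec (Fin q) n) (r : ℕ) → count q n (λ x → ham x u ≤ᵇ r) ≡ Vq q n r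
ball-volume q zero    []      zero    = refl
ball-volume q zero    []      (suc r) = cong (_+ 0) (ball-volume q zero [] r)
ball-volume q (suc n) (b ∷ u) zero    = begin
  count q (suc n) _                                 ≡⟨ count≡∑ q (suc n) _ ⟩
  ∑ (words q (suc n)) _                             ≡⟨ ∑-words-suc q n _ ⟩
  ∑Fin q _                                          ≡⟨ ∑Fin-single-≡ q b (Vq q n 0) 0 centre others ⟩
  Vq q n 0 + (q ∸ 1) * 0                            ≡⟨ cong (1 +_) (*-zeroʳ (q ∸ 1)) ⟩
  Vq q (suc n) 0                                    ∎
  where
  open ≡-Reasoning
  centre : ∑[ w ∈ words q n ] 𝟙 (ham (b ∷ w) (b ∷ u) ≤ᵇ 0) ≡ Vq q n 0
  centre rewrite mismatch-refl b = trans (sym (count≡∑ q n _)) (ball-volume q n u 0)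
  others : ∀ a → ¬ a ≡ b → ∑[ w ∈ words q n ] 𝟙 (ham (a ∷ w) (b ∷ u) ≤ᵇ 0) ≡ 0
  others a a≢b rewrite mismatch-≢ a≢b = ∑-zero (words q n) (λ _ → refl)
ball-volume q (suc n) (b ∷ u) (suc r) = begin
  count q (suc n) _                                 ≡⟨ count≡∑ q (suc n) _ ⟩
  ∑ (words q (suc n)) _                             ≡⟨ ∑-words-suc q n _ ⟩
  ∑Fin q _                                          ≡⟨ ∑Fin-single-≡ q b (Vq q n (suc r)) (Vq q n r) centre others ⟩
  Vq q n (suc r) + (q ∸ 1) * Vq q n r               ≡⟨ Vq-pascal q n r ⟨
  Vq q (suc n) (suc r)                              ∎
  where
  open ≡-Reasoning
  centre : ∑[ w ∈ words q n ] 𝟙 (ham (b ∷ w) (b ∷ u) ≤ᵇ suc r) ≡ Vq q n (suc r)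
  centre rewrite mismatch-refl b = trans (sym (count≡∑ q n _)) (ball-volume q n u (suc r))
  others : ∀ a → ¬ a ≡ b → ∑[ w ∈ words q n ] 𝟙 (ham (a ∷ w) (b ∷ u) ≤ᵇ suc r) ≡ Vq q n r
  others a a≢b rewrite mismatch-≢ a≢b =
    trans (∑-cong (words q n) (λ w → cong 𝟙 (suc-≤ᵇ-suc (ham w u) r)))
          (trans (sym (count≡∑ q n _)) (ball-volume q n u r))

-- Intersections of Hamming balls

Ellipse : (q n : ℕ) → Vec (Fin q) n → Vec (Fin q) n → ℕ → ℕ
Ellipse q n u v s = ∑[ x ∈ words q n ] 𝟙 (ham x u + ham x v ≤ᵇ s)

Ellipse-mono : (q n : ℕ) (u v : Vec (Fin q) n) {s s′ : ℕ} → s ≤ s′ → Ellipse q n u v s ≤ Ellipse q n u v s′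
Ellipse-mono q n u v s≤s′ = ∑-mono-≤ (words q n) (λ x → 𝟙-≤ᵇ-mono {ham x u + ham x v} (λ h → ≤-trans h s≤s′))

Ellipse-empty : (q n : ℕ) (u v : Vec (Fin q) n) {s : ℕ} → s < ham u v → Ellipse q n u v s ≡ 0
Ellipse-empty q n u v s<d =
  ∑-zero (words q n) (λ x → 𝟙-≤ᵇ-false (λ h → <⇒≱ s<d (≤-trans (ham-triangle x u v) h)))

module _ {q n : ℕ} (u v : Vec (Fin q) n) (a b c : Fin q) {s : ℕ} where

  EllipseSlice : ℕ
  EllipseSlice = ∑[ w ∈ words q n ] 𝟙 (ham (a ∷ w) (b ∷ u) + ham (a ∷ w) (c ∷ v) ≤ᵇ s)

  private
    regroup : ∀ x y z w → x + z + (y + w) ≡ (x + y) + (z + w)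
    regroup = solve-∀

  slice≤Ellipse : {s′ : ℕ} → s ≤ mismatch a b + mismatch a c + s′ → EllipseSlice ≤ Ellipse q n u v s′
  slice≤Ellipse {s′} s≤ = ∑-mono-≤ (words q n) (λ w → 𝟙-≤ᵇ-mono (λ h → +-cancelˡ-≤ j _ _
    (≤-trans (≤-reflexive (sym (regroup (mismatch a b) (mismatch a c) (ham w u) (ham w v)))) (≤-trans h s≤))))
    where j = mismatch a b + mismatch a c

  slice-empty : s < mismatch a b + mismatch a c + ham u v → EllipseSlice ≡ 0
  slice-empty s< = ∑-zero (words q n) (λ w → 𝟙-≤ᵇ-false (λ h → <⇒≱ s<
    (≤-trans (+-monoʳ-≤ (mismatch a b + mismatch a c) (ham-triangle w u v))
      (≤-trans (≤-reflexive (sym (regroup (mismatch a b) (mismatch a c) (ham w u) (ham w v)))) h))))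

mismatch-separates : {q : ℕ} {b c : Fin q} (a : Fin q) → ¬ b ≡ c → 1 ≤ mismatch a b + mismatch a c
mismatch-separates {b = b} {c} a b≢c with a ≟ b | a ≟ c
... | yes refl | yes refl = ⊥-elim (b≢c refl)
... | yes _    | no _     = s≤s z≤n
... | no _     | _        = s≤s z≤n

-- A point x with d(x,u) + d(x,v) ≤ d(u,v) + 2m + 1 may take any letters on the d(u,v) coordinates
-- where u and v differ, and differs from u in at most m of the others.
ellipse-bound : (q n : ℕ) (u v : Vec (Fin q) n) (m : ℕ) →
  Ellipse q n u v (ham u v + suc (2 * m)) ≤ q ^ ham u v * Vq q n m
ellipse-bound q zero    []      []      m = ≤-trans (Vq≥1 q 0 m) (≤-reflexive (sym (*-identityˡ _)))
ellipse-bound q (suc n) (b ∷ u) (c ∷ v) m with b ≟ c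
... | yes refl = agree m
  where
  d = ham u v
  centre : ∀ m → ∑[ w ∈ words q n ] 𝟙 (ham (b ∷ w) (b ∷ u) + ham (b ∷ w) (b ∷ v) ≤ᵇ d + suc (2 * m))
                 ≤ q ^ d * Vq q n m
  centre m = ≤-trans (slice≤Ellipse u v b b b (m≤n+m _ (mismatch b b + mismatch b b))) (ellipse-bound q n u v m)
  agree : ∀ m → Ellipse q (suc n) (b ∷ u) (b ∷ v) (d + suc (2 * m)) ≤ q ^ d * Vq q (suc n) m
  agree zero = begin
    Ellipse q (suc n) (b ∷ u) (b ∷ v) (d + 1)    ≡⟨ ∑-words-suc q n _ ⟩
    ∑Fin q _                                      ≤⟨ ∑Fin-single-≤ q b _ 0 (centre 0) others ⟩
    q ^ d * Vq q n 0 + (q ∸ 1) * 0               ≡⟨ cong (q ^ d * 1 +_) (*-zeroʳ (q ∸ 1)) ⟩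
    q ^ d * Vq q (suc n) 0 + 0                   ≡⟨ +-identityʳ _ ⟩
    q ^ d * Vq q (suc n) 0                       ∎
    where
    open ≤-Reasoning
    others : ∀ a → ¬ a ≡ b → ∑[ w ∈ words q n ] 𝟙 (ham (a ∷ w) (b ∷ u) + ham (a ∷ w) (b ∷ v) ≤ᵇ d + 1) ≤ 0
    others a a≢b = ≤-reflexive (slice-empty u v a b b (subst (λ j → d + 1 < j + d)
                     (sym (cong₂ _+_ (mismatch-≢ a≢b) (mismatch-≢ a≢b))) (≤-reflexive (+-comm (suc d) 1))))
  agree (suc m) = begin
    Ellipse q (suc n) (b ∷ u) (b ∷ v) (d + suc (2 * suc m))   ≡⟨ ∑-words-suc q n _ ⟩
    ∑Fin q _                                                   ≤⟨ ∑Fin-single-≤ q b _ _ (centre (suc m)) others ⟩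
    q ^ d * Vq q n (suc m) + (q ∸ 1) * (q ^ d * Vq q n m)     ≡⟨ factor (q ^ d) (Vq q n (suc m)) (q ∸ 1) (Vq q n m) ⟩
    q ^ d * (Vq q n (suc m) + (q ∸ 1) * Vq q n m)             ≡⟨ cong (q ^ d *_) (Vq-pascal q n m) ⟨
    q ^ d * Vq q (suc n) (suc m)                               ∎
    where
    open ≤-Reasoning
    factor : ∀ Q A p B → Q * A + p * (Q * B) ≡ Q * (A + p * B)
    factor = solve-∀
    two-more : ∀ d m → d + suc (2 * suc m) ≡ 2 + (d + suc (2 * m))
    two-more = solve-∀
    others : ∀ a → ¬ a ≡ b → ∑[ w ∈ words q n ] 𝟙 (ham (a ∷ w) (b ∷ u) + ham (a ∷ w) (b ∷ v) ≤ᵇ d + suc (2 * suc m))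
                             ≤ q ^ d * Vq q n m
    others a a≢b = ≤-trans (slice≤Ellipse u v a b b (subst (λ j → d + suc (2 * suc m) ≤ j + (d + suc (2 * m)))
                              (sym (cong₂ _+_ (mismatch-≢ a≢b) (mismatch-≢ a≢b))) (≤-reflexive (two-more d m))))
                           (ellipse-bound q n u v m)
... | no b≢c = disagree
  where
  d = ham u v
  disagree : Ellipse q (suc n) (b ∷ u) (c ∷ v) (suc d + suc (2 * m)) ≤ q ^ suc d * Vq q (suc n) m
  disagree = begin
    Ellipse q (suc n) (b ∷ u) (c ∷ v) (suc d + suc (2 * m))   ≡⟨ ∑-words-suc q n _ ⟩
    ∑Fin q _                                                   ≤⟨ ∑Fin-≤-const q _ (λ a →
                                                                    slice≤Ellipse u v a b c (+-monoˡ-≤ _ (mismatch-separates a b≢c))) ⟩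
    q * Ellipse q n u v (d + suc (2 * m))                      ≤⟨ *-monoʳ-≤ q (ellipse-bound q n u v m) ⟩
    q * (q ^ d * Vq q n m)                                     ≡⟨ *-assoc q (q ^ d) _ ⟨
    q ^ suc d * Vq q n m                                       ≤⟨ *-monoʳ-≤ (q ^ suc d) (Vq-mono-n q n m) ⟩
    q ^ suc d * Vq q (suc n) m                                 ∎
    where open ≤-Reasoning

-- Ratios of ball volumes

[k+1]*[n+1]C[k+1]≡[n+1]*nCk : ∀ n k → suc k * (suc n C suc k) ≡ suc n * (n C k)
[k+1]*[n+1]C[k+1]≡[n+1]*nCk n       zero    = trans (+-identityʳ _) (trans (nC1≡n (suc n)) (sym (*-identityʳ (suc n))))
[k+1]*[n+1]C[k+1]≡[n+1]*nCk zero    (suc k) = *-zeroʳ (suc (suc k))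
[k+1]*[n+1]C[k+1]≡[n+1]*nCk (suc n) (suc k) = begin
  suc (suc k) * (suc (suc n) C suc (suc k))
    ≡⟨ cong (suc (suc k) *_) (nCk+nC[k+1]≡[n+1]C[k+1] (suc n) (suc k)) ⟨
  suc (suc k) * (A + B)
    ≡⟨ spread k A B ⟩
  A + (suc k * A + suc (suc k) * B)
    ≡⟨ cong₂ (λ x y → A + (x + y)) ([k+1]*[n+1]C[k+1]≡[n+1]*nCk n k) ([k+1]*[n+1]C[k+1]≡[n+1]*nCk n (suc k)) ⟩
  A + (suc n * (n C k) + suc n * (n C suc k))
    ≡⟨ cong (A +_) (*-distribˡ-+ (suc n) (n C k) (n C suc k)) ⟨
  A + suc n * (n C k + n C suc k)
    ≡⟨ cong (λ x → A + suc n * x) (nCk+nC[k+1]≡[n+1]C[k+1] n k) ⟩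
  A + suc n * A ∎
  where
  open ≡-Reasoning
  A = suc n C suc k
  B = suc n C suc (suc k)
  spread : ∀ k a b → suc (suc k) * (a + b) ≡ a + (suc k * a + suc (suc k) * b)
  spread = solve-∀

nCk*[n∸k]≤[k+1]*nC[k+1] : ∀ n k → (n C k) * (n ∸ k) ≤ suc k * (n C suc k)
nCk*[n∸k]≤[k+1]*nC[k+1] n k with ≤-total k n
... | inj₂ n≤k = ≤-trans (≤-reflexive (trans (cong ((n C k) *_) (m≤n⇒m∸n≡0 n≤k)) (*-zeroʳ (n C k)))) z≤n
... | inj₁ k≤n = ≤-reflexive (+-cancelʳ-≡ (suc k * (n C k)) _ _ (begin
  (n C k) * (n ∸ k) + suc k * (n C k) ≡⟨ collect (n C k) (n ∸ k) k ⟩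
  (suc k + (n ∸ k)) * (n C k)         ≡⟨ cong (λ x → suc x * (n C k)) (m+[n∸m]≡n k≤n) ⟩
  suc n * (n C k)                     ≡⟨ [k+1]*[n+1]C[k+1]≡[n+1]*nCk n k ⟨
  suc k * (suc n C suc k)             ≡⟨ cong (suc k *_) (nCk+nC[k+1]≡[n+1]C[k+1] n k) ⟨
  suc k * (n C k + n C suc k)         ≡⟨ spread k (n C k) (n C suc k) ⟩
  suc k * (n C suc k) + suc k * (n C k) ∎))
  where
  open ≡-Reasoning
  collect : ∀ c m k → c * m + suc k * c ≡ (suc k + m) * c
  collect = solve-∀
  spread : ∀ k a b → suc k * (a + b) ≡ suc k * b + suc k * a
  spread = solve-∀

Vq-term : ℕ → ℕ → ℕ → ℕ
Vq-term q n i = (n C i) * (q ∸ 1) ^ i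

Vq-term-ratio : ∀ q n i → 2 ≤ q → Vq-term q n i * (n ∸ i) ≤ suc i * Vq-term q n (suc i)
Vq-term-ratio q n i 2≤q = begin
  Vq-term q n i * (n ∸ i)                            ≤⟨ m≤m*n _ (q ∸ 1) ⦃ ℕ.>-nonZero (∸-monoˡ-≤ 1 2≤q) ⦄ ⟩
  Vq-term q n i * (n ∸ i) * (q ∸ 1)                  ≡⟨ regroup (n C i) ((q ∸ 1) ^ i) (n ∸ i) (q ∸ 1) ⟩
  ((n C i) * (n ∸ i)) * ((q ∸ 1) * (q ∸ 1) ^ i)      ≤⟨ *-monoˡ-≤ _ (nCk*[n∸k]≤[k+1]*nC[k+1] n i) ⟩
  (suc i * (n C suc i)) * ((q ∸ 1) * (q ∸ 1) ^ i)    ≡⟨ *-assoc (suc i) (n C suc i) ((q ∸ 1) ^ suc i) ⟩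
  suc i * Vq-term q n (suc i)                        ∎
  where
  open ≤-Reasoning
  regroup : ∀ c P m p → c * P * m * p ≡ c * m * (p * P)
  regroup = solve-∀

Vq-ratio : ∀ q n r → 2 ≤ q → Vq q n r * (n ∸ r) ≤ suc r * Vq q n (suc r)
Vq-ratio q n zero    2≤q = ≤-trans (Vq-term-ratio q n 0 2≤q) (*-monoʳ-≤ 1 (m≤n+m _ _))
Vq-ratio q n (suc r) 2≤q = begin
  (Vq q n r + Vq-term q n (suc r)) * (n ∸ suc r)
    ≡⟨ *-distribʳ-+ (n ∸ suc r) (Vq q n r) (Vq-term q n (suc r)) ⟩
  Vq q n r * (n ∸ suc r) + Vq-term q n (suc r) * (n ∸ suc r)
    ≤⟨ +-monoˡ-≤ _ (*-monoʳ-≤ (Vq q n r) (∸-monoʳ-≤ n (n≤1+n r))) ⟩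
  Vq q n r * (n ∸ r) + Vq-term q n (suc r) * (n ∸ suc r)
    ≤⟨ +-mono-≤ (Vq-ratio q n r 2≤q) (Vq-term-ratio q n (suc r) 2≤q) ⟩
  suc r * Vq q n (suc r) + suc (suc r) * Vq-term q n (suc (suc r))
    ≤⟨ +-monoˡ-≤ _ (*-monoˡ-≤ (Vq q n (suc r)) (n≤1+n (suc r))) ⟩
  suc (suc r) * Vq q n (suc r) + suc (suc r) * Vq-term q n (suc (suc r))
    ≡⟨ *-distribˡ-+ (suc (suc r)) (Vq q n (suc r)) (Vq-term q n (suc (suc r))) ⟨
  suc (suc r) * Vq q n (suc (suc r)) ∎
  where open ≤-Reasoning

Vq-shrink : ∀ q n t j → 2 ≤ q → j ≤ t → Vq q n (t ∸ j) * (n ∸ t) ^ j ≤ t ^ j * Vq q n t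
Vq-shrink q n t zero    2≤q _   = ≤-reflexive (trans (*-identityʳ _) (sym (*-identityˡ _)))
Vq-shrink q n t (suc j) 2≤q j<t = begin
  Vq q n r * ((n ∸ t) * (n ∸ t) ^ j)         ≡⟨ *-assoc (Vq q n r) _ _ ⟨
  Vq q n r * (n ∸ t) * (n ∸ t) ^ j           ≤⟨ *-monoˡ-≤ _ (*-monoʳ-≤ (Vq q n r) (∸-monoʳ-≤ n (m∸n≤m t (suc j)))) ⟩
  Vq q n r * (n ∸ r) * (n ∸ t) ^ j           ≤⟨ *-monoˡ-≤ _ (Vq-ratio q n r 2≤q) ⟩
  suc r * Vq q n (suc r) * (n ∸ t) ^ j       ≡⟨ cong (λ x → x * Vq q n x * (n ∸ t) ^ j) (+-∸-assoc 1 j<t) ⟨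
  (t ∸ j) * Vq q n (t ∸ j) * (n ∸ t) ^ j     ≡⟨ *-assoc (t ∸ j) _ _ ⟩
  (t ∸ j) * (Vq q n (t ∸ j) * (n ∸ t) ^ j)   ≤⟨ *-mono-≤ (m∸n≤m t j) (Vq-shrink q n t j 2≤q (≤-trans (n≤1+n j) j<t)) ⟩
  t * (t ^ j * Vq q n t)                     ≡⟨ *-assoc t _ _ ⟨
  t ^ suc j * Vq q n t                       ∎
  where
  open ≤-Reasoning
  r = t ∸ suc j

-- Double counting

∑≤1+∑offDiagonal : {A : Set} (W : List A) (a : A → ℕ) → (∀ u → a u ≤ 1) →
  (same : A → A → Bool) → (∀ u → ∑[ v ∈ W ] 𝟙 (same v u) ≤ 1) →
  ∑ W a ≤ 1 + ∑[ u ∈ W ] (a u * ∑[ v ∈ W ] (a v * 𝟙 (not (same v u))))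
∑≤1+∑offDiagonal {A} W a a≤1 same unique = ≤-trans (c≤1+c*[c∸1] c) (+-monoʳ-≤ 1 (begin
  c * (c ∸ 1)                          ≡⟨ *-comm c (c ∸ 1) ⟩
  (c ∸ 1) * c                          ≡⟨ ∑-*ˡ W (c ∸ 1) a ⟨
  ∑[ u ∈ W ] ((c ∸ 1) * a u)            ≤⟨ ∑-mono-≤ W (λ u → ≤-trans (≤-reflexive (*-comm (c ∸ 1) (a u)))
                                            (*-monoʳ-≤ (a u) (≤-trans (∸-monoˡ-≤ 1 (c≤others+1 u)) (≤-reflexive (m+n∸n≡m (others u) 1))))) ⟩
  ∑[ u ∈ W ] (a u * others u)          ∎))
  where
  open ≤-Reasoning
  c = ∑ W a
  others : A → ℕ
  others u = ∑[ v ∈ W ] (a v * 𝟙 (not (same v u)))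
  split : ∀ u v → a v ≤ a v * 𝟙 (not (same v u)) + 𝟙 (same v u)
  split u v with same v u
  ... | true  = ≤-trans (a≤1 v) (m≤n+m 1 _)
  ... | false = ≤-reflexive (sym (trans (+-identityʳ _) (*-identityʳ _)))
  c≤others+1 : ∀ u → c ≤ others u + 1
  c≤others+1 u = begin
    c                                                       ≤⟨ ∑-mono-≤ W (split u) ⟩
    ∑[ v ∈ W ] (a v * 𝟙 (not (same v u)) + 𝟙 (same v u))   ≡⟨ ∑-+ W _ _ ⟩
    others u + ∑[ v ∈ W ] 𝟙 (same v u)                      ≤⟨ +-monoʳ-≤ (others u) (unique u) ⟩
    others u + 1                                            ∎
  c≤1+c*[c∸1] : ∀ c → c ≤ 1 + c * (c ∸ 1)
  c≤1+c*[c∸1] zero    = z≤n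
  c≤1+c*[c∸1] (suc c) = s≤s (m≤m+n c (c * c))

module _ {q n : ℕ} (t : ℕ) where

  ballOverlap : Vec (Fin q) n → Vec (Fin q) n → ℕ
  ballOverlap u v = ∑[ x ∈ words q n ] (𝟙 (ham x u ≤ᵇ t) * 𝟙 (ham x v ≤ᵇ t))

  ballOverlaps : (Vec (Fin q) n → Bool) → Vec (Fin q) n → ℕ
  ballOverlaps T u = ∑[ v ∈ words q n ] (𝟙 (T v) * 𝟙 (not (ham v u ≡ᵇ 0)) * ballOverlap u v)

≡ᵇ0≡≤ᵇ0 : ∀ m → (m ≡ᵇ 0) ≡ (m ≤ᵇ 0)
≡ᵇ0≡≤ᵇ0 zero    = refl
≡ᵇ0≡≤ᵇ0 (suc m) = refl

count*Vq≤ : (q n t : ℕ) (T : Vec (Fin q) n → Bool) →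
  count q n T * Vq q n t ≤ q ^ n + ∑[ u ∈ words q n ] (𝟙 (T u) * ballOverlaps t T u)
count*Vq≤ q n t T = begin
  count q n T * Vq q n t
    ≡⟨ cong (_* Vq q n t) (count≡∑ q n T) ⟩
  (∑[ u ∈ W ] 𝟙 (T u)) * Vq q n t
    ≡⟨ trans (*-comm _ (Vq q n t)) (sym (∑-*ˡ W (Vq q n t) (λ u → 𝟙 (T u)))) ⟩
  ∑[ u ∈ W ] (Vq q n t * 𝟙 (T u))
    ≡⟨ ∑-cong W (λ u → trans (*-comm (Vq q n t) _)
         (cong (𝟙 (T u) *_) (trans (sym (ball-volume q n u t)) (count≡∑ q n _)))) ⟩
  ∑[ u ∈ W ] (𝟙 (T u) * ∑[ x ∈ W ] 𝟙 (ham x u ≤ᵇ t))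
    ≡⟨ ∑-cong W (λ u → sym (∑-*ˡ W (𝟙 (T u)) _)) ⟩
  ∑[ u ∈ W ] ∑[ x ∈ W ] covers x u
    ≡⟨ ∑-comm W W (λ u x → covers x u) ⟩
  ∑[ x ∈ W ] ∑[ u ∈ W ] covers x u
    ≤⟨ ∑-mono-≤ W (λ x → ∑≤1+∑offDiagonal W (covers x) (covers≤1 x) (λ v u → ham v u ≡ᵇ 0) centre-unique) ⟩
  ∑[ x ∈ W ] (1 + ∑[ u ∈ W ] (covers x u * ∑[ v ∈ W ] (covers x v * 𝟙 (not (ham v u ≡ᵇ 0)))))
    ≡⟨ ∑-+ W (λ _ → 1) _ ⟩
  ∑[ _ ∈ W ] 1 + ∑[ x ∈ W ] ∑[ u ∈ W ] (covers x u * ∑[ v ∈ W ] (covers x v * 𝟙 (not (ham v u ≡ᵇ 0))))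
    ≡⟨ cong₂ _+_ (∑-words-1 q n) pairs ⟩
  q ^ n + ∑[ u ∈ W ] (𝟙 (T u) * ballOverlaps t T u) ∎
  where
  open ≤-Reasoning
  W = words q n
  covers : Vec (Fin q) n → Vec (Fin q) n → ℕ
  covers x u = 𝟙 (T u) * 𝟙 (ham x u ≤ᵇ t)
  covers≤1 : ∀ x u → covers x u ≤ 1
  covers≤1 x u = *-mono-≤ (𝟙≤1 (T u)) (𝟙≤1 (ham x u ≤ᵇ t))
  centre-unique : ∀ u → ∑[ v ∈ W ] 𝟙 (ham v u ≡ᵇ 0) ≤ 1
  centre-unique u = ≤-reflexive (trans (∑-cong W (λ v → cong 𝟙 (≡ᵇ0≡≤ᵇ0 (ham v u))))
                                       (trans (sym (count≡∑ q n _)) (ball-volume q n u 0)))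
  regroup : ∀ a b c d e → a * b * (c * d * e) ≡ a * (c * e * (b * d))
  regroup = solve-∀
  pairs : ∑[ x ∈ W ] ∑[ u ∈ W ] (covers x u * ∑[ v ∈ W ] (covers x v * 𝟙 (not (ham v u ≡ᵇ 0))))
          ≡ ∑[ u ∈ W ] (𝟙 (T u) * ballOverlaps t T u)
  pairs = begin-equality
    ∑[ x ∈ W ] ∑[ u ∈ W ] (covers x u * ∑[ v ∈ W ] (covers x v * 𝟙 (not (ham v u ≡ᵇ 0))))
      ≡⟨ ∑-comm W W _ ⟩
    ∑[ u ∈ W ] ∑[ x ∈ W ] (covers x u * ∑[ v ∈ W ] (covers x v * 𝟙 (not (ham v u ≡ᵇ 0))))
      ≡⟨ ∑-cong W (λ u → ∑-cong W (λ x → sym (∑-*ˡ W (covers x u) _))) ⟩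
    ∑[ u ∈ W ] ∑[ x ∈ W ] ∑[ v ∈ W ] (covers x u * (covers x v * 𝟙 (not (ham v u ≡ᵇ 0))))
      ≡⟨ ∑-cong W (λ u → ∑-comm W W _) ⟩
    ∑[ u ∈ W ] ∑[ v ∈ W ] ∑[ x ∈ W ] (covers x u * (covers x v * 𝟙 (not (ham v u ≡ᵇ 0))))
      ≡⟨ ∑-cong W (λ u → ∑-cong W (λ v → ∑-cong W (λ x →
           regroup (𝟙 (T u)) (𝟙 (ham x u ≤ᵇ t)) (𝟙 (T v)) (𝟙 (ham x v ≤ᵇ t)) (𝟙 (not (ham v u ≡ᵇ 0)))))) ⟩
    ∑[ u ∈ W ] ∑[ v ∈ W ] ∑[ x ∈ W ] (𝟙 (T u) * (𝟙 (T v) * 𝟙 (not (ham v u ≡ᵇ 0)) * (𝟙 (ham x u ≤ᵇ t) * 𝟙 (ham x v ≤ᵇ t))))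
      ≡⟨ ∑-cong W (λ u → ∑-cong W (λ v → trans (∑-*ˡ W (𝟙 (T u)) _)
           (cong (𝟙 (T u) *_) (∑-*ˡ W (𝟙 (T v) * 𝟙 (not (ham v u ≡ᵇ 0))) _)))) ⟩
    ∑[ u ∈ W ] ∑[ v ∈ W ] (𝟙 (T u) * (𝟙 (T v) * 𝟙 (not (ham v u ≡ᵇ 0)) * ballOverlap t u v))
      ≡⟨ ∑-cong W (λ u → ∑-*ˡ W (𝟙 (T u)) _) ⟩
    ∑[ u ∈ W ] (𝟙 (T u) * ballOverlaps t T u) ∎

ceilHalf*2≤1+ : ∀ d → ceilHalf d * 2 ≤ d + 1
ceilHalf*2≤1+ d = m/n*n≤m (d + 1) 2

≤ceilHalf*2 : ∀ d → d ≤ ceilHalf d * 2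
≤ceilHalf*2 d = ≤-pred (begin
  suc d                                       ≡⟨ +-comm 1 d ⟩
  d + 1                                       ≡⟨ m≡m%n+[m/n]*n (d + 1) 2 ⟩
  (d + 1) ℕ.% 2 + ceilHalf d * 2              ≤⟨ +-monoˡ-≤ (ceilHalf d * 2) (≤-pred (m%n<n (d + 1) 2)) ⟩
  1 + ceilHalf d * 2                          ∎)
  where open ≤-Reasoning

ceilHalf≤ : ∀ {d t} → d ≤ 2 * t → ceilHalf d ≤ t
ceilHalf≤ {d} {t} d≤2t = m<1+n⇒m≤n (*-cancelʳ-< 2 (ceilHalf d) (suc t) (begin-strict
  ceilHalf d * 2   ≤⟨ ceilHalf*2≤1+ d ⟩
  d + 1            ≤⟨ +-monoˡ-≤ 1 d≤2t ⟩
  2 * t + 1        <⟨ n<1+n _ ⟩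
  suc (2 * t + 1)  ≡⟨ double-suc t ⟩
  suc t * 2        ∎))
  where
  open ≤-Reasoning
  double-suc : ∀ t → suc (2 * t + 1) ≡ suc t * 2
  double-suc = solve-∀

ceilHalf-slack : ∀ {d t} → d ≤ 2 * t → 2 * t ≤ d + suc (2 * (t ∸ ceilHalf d))
ceilHalf-slack {d} {t} d≤2t = begin
  2 * t                          ≡⟨ cong (2 *_) (m∸n+n≡m (ceilHalf≤ d≤2t)) ⟨
  2 * (m + ceilHalf d)           ≡⟨ expand m (ceilHalf d) ⟩
  2 * m + ceilHalf d * 2         ≤⟨ +-monoʳ-≤ (2 * m) (ceilHalf*2≤1+ d) ⟩
  2 * m + (d + 1)                ≡⟨ rearrange m d ⟩
  d + suc (2 * m)                ∎
  where
  open ≤-Reasoning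
  m = t ∸ ceilHalf d
  expand : ∀ m c → 2 * (m + c) ≡ 2 * m + c * 2
  expand = solve-∀
  rearrange : ∀ m d → 2 * m + (d + 1) ≡ d + suc (2 * m)
  rearrange = solve-∀

𝟙-≤ᵇ-add : ∀ a b t → 𝟙 (a ≤ᵇ t) * 𝟙 (b ≤ᵇ t) ≤ 𝟙 (a + b ≤ᵇ 2 * t)
𝟙-≤ᵇ-add a b t with a ≤ᵇ t in a≤t | b ≤ᵇ t in b≤t
... | false | _     = z≤n
... | true  | false = z≤n
... | true  | true  = ≤-reflexive (sym (𝟙-≤ᵇ-true a+b≤2t))
  where
  a+b≤2t : a + b ≤ 2 * t
  a+b≤2t = ≤-trans (+-mono-≤ (≤ᵇ⇒≤ a t (≡true⇒T a≤t)) (≤ᵇ⇒≤ b t (≡true⇒T b≤t)))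
                   (≤-reflexive (cong (t +_) (sym (+-identityʳ t))))

ballOverlap≤Ellipse : (q n t : ℕ) (u v : Vec (Fin q) n) → ballOverlap t u v ≤ Ellipse q n u v (2 * t)
ballOverlap≤Ellipse q n t u v = ∑-mono-≤ (words q n) (λ x → 𝟙-≤ᵇ-add (ham x u) (ham x v) t)

overlapBound : (q n t d : ℕ) → ℕ
overlapBound q n t d = 𝟙 (d ≤ᵇ 2 * t) * (q ^ d * Vq q n (t ∸ ceilHalf d))

-- B(u,t) ∩ B(v,t) lies in the ellipse with foci u, v and major axis 2t ≤ d(u,v) + 1 + 2(t − ⌈d(u,v)/2⌉).
ballOverlap≤ : (q n t : ℕ) (u v : Vec (Fin q) n) → ballOverlap t u v ≤ overlapBound q n t (ham v u)
ballOverlap≤ q n t u v with ham v u ≤ᵇ 2 * t in d≤2t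
... | false = ≤-trans (ballOverlap≤Ellipse q n t u v) (≤-reflexive (Ellipse-empty q n u v
                (≤-trans (≰⇒> (λ h → subst T d≤2t (≤⇒≤ᵇ h))) (≤-reflexive (ham-sym v u)))))
... | true  = begin
  ballOverlap t u v                    ≤⟨ ballOverlap≤Ellipse q n t u v ⟩
  Ellipse q n u v (2 * t)              ≤⟨ Ellipse-mono q n u v (ceilHalf-slack d≤2t′) ⟩
  Ellipse q n u v (ham v u + suc (2 * m)) ≡⟨ cong (λ d → Ellipse q n u v (d + suc (2 * m))) (ham-sym v u) ⟩
  Ellipse q n u v (ham u v + suc (2 * m)) ≤⟨ ellipse-bound q n u v m ⟩
  q ^ ham u v * Vq q n m               ≡⟨ cong (λ d → q ^ d * Vq q n m) (ham-sym u v) ⟩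
  q ^ ham v u * Vq q n m               ≡⟨ +-identityʳ _ ⟨
  1 * (q ^ ham v u * Vq q n m)         ∎
  where
  open ≤-Reasoning
  m = t ∸ ceilHalf (ham v u)
  d≤2t′ : ham v u ≤ 2 * t
  d≤2t′ = ≤ᵇ⇒≤ (ham v u) (2 * t) (≡true⇒T d≤2t)

smallDistances : List ℕ
smallDistances = map suc (upTo 20)

≡ᵇ-refl : ∀ m → (m ≡ᵇ m) ≡ true
≡ᵇ-refl m = T⇒≡true (≡⇒≡ᵇ m m refl)

split-by-distance : (R : ℕ → ℕ) (s : Bool) (d B : ℕ) → B ≤ R d →
  𝟙 s * 𝟙 (not (d ≡ᵇ 0)) * B ≤ ∑[ k ∈ smallDistances ] (𝟙 (s ∧ (d ≡ᵇ k)) * R k) + 𝟙 s * (𝟙 (21 ≤ᵇ d) * R d)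
split-by-distance R false d       B _   = z≤n
split-by-distance R true  zero    B _   = z≤n
split-by-distance R true  (suc d) B B≤R with suc d ≤? 20
... | yes d≤20 = begin
  1 * 1 * B                                           ≡⟨ *-identityˡ B ⟩
  B                                                   ≤⟨ B≤R ⟩
  R (suc d)                                           ≡⟨ *-identityˡ (R (suc d)) ⟨
  1 * R (suc d)                                       ≡⟨ cong (λ b → 𝟙 b * R (suc d)) (≡ᵇ-refl d) ⟨
  𝟙 (suc d ≡ᵇ suc d) * R (suc d)                       ≤⟨ term≤∑ smallDistances (λ k → 𝟙 (suc d ≡ᵇ k) * R k)
                                                           (∈-map⁺ suc (∈-upTo⁺ d≤20)) ⟩
  ∑[ k ∈ smallDistances ] (𝟙 (suc d ≡ᵇ k) * R k)       ≤⟨ m≤m+n near far ⟩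
  near + far ∎
  where
  open ≤-Reasoning
  near = ∑[ k ∈ smallDistances ] (𝟙 (suc d ≡ᵇ k) * R k)
  far = 1 * (𝟙 (21 ≤ᵇ suc d) * R (suc d))
... | no d≰20 = begin
  1 * 1 * B                                           ≡⟨ *-identityˡ B ⟩
  B                                                   ≤⟨ B≤R ⟩
  R (suc d)                                           ≡⟨ *-identityˡ (R (suc d)) ⟨
  1 * R (suc d)                                       ≡⟨ cong (λ x → x * R (suc d)) (𝟙-≤ᵇ-true (≰⇒> d≰20)) ⟨
  𝟙 (21 ≤ᵇ suc d) * R (suc d)                          ≡⟨ *-identityˡ _ ⟨
  1 * (𝟙 (21 ≤ᵇ suc d) * R (suc d))                    ≤⟨ m≤n+m far near ⟩
  near + far ∎
  where
  open ≤-Reasoning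
  near = ∑[ k ∈ smallDistances ] (𝟙 (suc d ≡ᵇ k) * R k)
  far = 1 * (𝟙 (21 ≤ᵇ suc d) * R (suc d))

farOverlap : (q n t : ℕ) → (Vec (Fin q) n → Bool) → Vec (Fin q) n → Vec (Fin q) n → ℕ
farOverlap q n t S u v = 𝟙 (S v) * (𝟙 (21 ≤ᵇ ham v u) * overlapBound q n t (ham v u))

ballOverlaps≤ : (q n t : ℕ) (S T : Vec (Fin q) n → Bool) → (∀ v → T v ≡ true → S v ≡ true) →
  (u : Vec (Fin q) n) →
  ballOverlaps t T u ≤ ∑[ k ∈ smallDistances ] (overlapBound q n t k * degk q n S u k)
                       + ∑[ v ∈ words q n ] farOverlap q n t S u v
ballOverlaps≤ q n t S T T⊆S u = begin
  ballOverlaps t T u                              ≤⟨ ∑-mono-≤ W pointwise ⟩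
  ∑[ v ∈ W ] (near v + farOverlap q n t S u v)    ≡⟨ ∑-+ W near (farOverlap q n t S u) ⟩
  ∑ W near + ∑[ v ∈ W ] farOverlap q n t S u v    ≡⟨ cong (_+ ∑ W (farOverlap q n t S u)) near-by-distance ⟩
  ∑[ k ∈ smallDistances ] (overlapBound q n t k * degk q n S u k) + ∑[ v ∈ W ] farOverlap q n t S u v ∎
  where
  open ≤-Reasoning
  W = words q n
  near : Vec (Fin q) n → ℕ
  near v = ∑[ k ∈ smallDistances ] (𝟙 (S v ∧ (ham v u ≡ᵇ k)) * overlapBound q n t k)
  pointwise : ∀ v → 𝟙 (T v) * 𝟙 (not (ham v u ≡ᵇ 0)) * ballOverlap t u v ≤ near v + farOverlap q n t S u v
  pointwise v with T v in Tv
  ... | false = z≤n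
  ... | true rewrite T⊆S v Tv = split-by-distance (overlapBound q n t) true (ham v u) _ (ballOverlap≤ q n t u v)
  near-by-distance : ∑ W near ≡ ∑[ k ∈ smallDistances ] (overlapBound q n t k * degk q n S u k)
  near-by-distance =
    trans (∑-comm W smallDistances (λ v k → 𝟙 (S v ∧ (ham v u ≡ᵇ k)) * overlapBound q n t k))
          (∑-cong smallDistances (λ k →
            trans (∑-cong W (λ v → *-comm (𝟙 (S v ∧ (ham v u ≡ᵇ k))) (overlapBound q n t k)))
                  (trans (∑-*ˡ W (overlapBound q n t k) _) (cong (overlapBound q n t k *_) (sym (count≡∑ q n _))))))

-- Estimates for large n

m*m≤n*n⇒m≤n : ∀ m n → m * m ≤ n * n → m ≤ n
m*m≤n*n⇒m≤n m n m²≤n² with m ≤? n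
... | yes m≤n = m≤n
... | no m≰n  = ⊥-elim (<⇒≱ (*-mono-< (≰⇒> m≰n) (≰⇒> m≰n)) m²≤n²)

^-distribʳ-* : ∀ m n k → (m * n) ^ k ≡ m ^ k * n ^ k
^-distribʳ-* m n zero    = refl
^-distribʳ-* m n (suc k) rewrite ^-distribʳ-* m n k = interchange m n (m ^ k) (n ^ k)
  where
  interchange : ∀ m n a b → m * n * (a * b) ≡ m * a * (n * b)
  interchange = solve-∀

11≤ceilHalf : ∀ {d} → 21 ≤ d → 11 ≤ ceilHalf d
11≤ceilHalf {d} 21≤d = *-cancelʳ-< 2 10 (ceilHalf d) (≤-trans 21≤d (≤ceilHalf*2 d))

0<d⇒≡ᵇ0-false : ∀ {d} → 0 < d → (d ≡ᵇ 0) ≡ false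
0<d⇒≡ᵇ0-false (s≤s _) = refl

smallDistances≤20 : All (_≤ 20) smallDistances
smallDistances≤20 = toWitness {a? = All.all? (_≤? 20) smallDistances} tt

nearConstant : ℕ → ℕ
nearConstant q = q ^ 20 * 20 ^ 10

degreeConstant : ℕ → ℕ
degreeConstant q = suc (20 * nearConstant q)

farConstant : ℕ → ℕ
farConstant q = (400 * q ^ 4) ^ 11

module LargeDimension (q n t : ℕ) (2≤q : 2 ≤ q) (t²≤100n : t * t ≤ 100 * n) (400q⁴≤n : 400 * q ^ 4 ≤ n) where

  V : ℕ
  V = Vq q n t

  Z : ℕ
  Z = 2 * t * (q * q)

  instance
    q-nonZero : NonZero q
    q-nonZero = ℕ.>-nonZero (≤-trans (s≤s z≤n) 2≤q)

    n-nonZero : NonZero n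
    n-nonZero = ℕ.>-nonZero (≤-trans (s≤s z≤n) (≤-trans (*-monoʳ-≤ 400 (^-monoˡ-≤ 4 (≤-trans (s≤s z≤n) 2≤q))) 400q⁴≤n))

  [2t]²≤400n : (2 * t) * (2 * t) ≤ 400 * n
  [2t]²≤400n = ≤-trans (≤-reflexive (square t)) (≤-trans (*-monoʳ-≤ 4 t²≤100n) (≤-reflexive (scale n)))
    where
    square : ∀ t → (2 * t) * (2 * t) ≡ 4 * (t * t)
    square = solve-∀
    scale : ∀ n → 4 * (100 * n) ≡ 400 * n
    scale = solve-∀

  Z²≤400q⁴n : Z * Z ≤ (400 * q ^ 4) * n
  Z²≤400q⁴n = begin
    Z * Z                              ≡⟨ square t q ⟩
    (2 * t) * (2 * t) * q ^ 4          ≤⟨ *-monoˡ-≤ (q ^ 4) [2t]²≤400n ⟩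
    400 * n * q ^ 4                    ≡⟨ rearrange n (q ^ 4) ⟩
    (400 * q ^ 4) * n                  ∎
    where
    open ≤-Reasoning
    square : ∀ t q → 2 * t * (q * q) * (2 * t * (q * q)) ≡ (2 * t) * (2 * t) * (q * (q * (q * (q * 1))))
    square = solve-∀
    rearrange : ∀ n Q → 400 * n * Q ≡ (400 * Q) * n
    rearrange = solve-∀

  Z≤n : Z ≤ n
  Z≤n = m*m≤n*n⇒m≤n Z n (≤-trans Z²≤400q⁴n (*-monoˡ-≤ n 400q⁴≤n))

  n≤2[n∸t] : n ≤ 2 * (n ∸ t)
  n≤2[n∸t] = begin
    n                    ≡⟨ m∸n+n≡m (≤-trans (m≤n+m t t) 2t≤n) ⟨
    (n ∸ t) + t          ≤⟨ +-monoʳ-≤ (n ∸ t) (≤-trans (≤-reflexive (sym (m+n∸n≡m t t))) (∸-monoˡ-≤ t 2t≤n)) ⟩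
    (n ∸ t) + (n ∸ t)    ≡⟨ cong ((n ∸ t) +_) (+-identityʳ (n ∸ t)) ⟨
    2 * (n ∸ t)          ∎
    where
    open ≤-Reasoning
    2t≤n : t + t ≤ n
    2t≤n = ≤-trans (≤-reflexive (cong (t +_) (sym (+-identityʳ t)))) (≤-trans (m≤m*n (2 * t) (q * q) ⦃ m*n≢0 q q ⦄) Z≤n)

  Vq-shrink-n : ∀ j → j ≤ t → Vq q n (t ∸ j) * n ^ j ≤ (2 * t) ^ j * V
  Vq-shrink-n j j≤t = begin
    W * n ^ j                    ≤⟨ *-monoʳ-≤ W (^-monoˡ-≤ j n≤2[n∸t]) ⟩
    W * (2 * (n ∸ t)) ^ j        ≡⟨ cong (W *_) (^-distribʳ-* 2 (n ∸ t) j) ⟩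
    W * (2 ^ j * (n ∸ t) ^ j)    ≡⟨ swap W (2 ^ j) ((n ∸ t) ^ j) ⟩
    2 ^ j * (W * (n ∸ t) ^ j)    ≤⟨ *-monoʳ-≤ (2 ^ j) (Vq-shrink q n t j 2≤q j≤t) ⟩
    2 ^ j * (t ^ j * V)          ≡⟨ *-assoc (2 ^ j) (t ^ j) V ⟨
    2 ^ j * t ^ j * V            ≡⟨ cong (_* V) (^-distribʳ-* 2 t j) ⟨
    (2 * t) ^ j * V              ∎
    where
    open ≤-Reasoning
    W = Vq q n (t ∸ j)
    swap : ∀ a b c → a * (b * c) ≡ b * (a * c)
    swap = solve-∀

  Vq-shrink-n² : ∀ j → j ≤ t → Vq q n (t ∸ j) * Vq q n (t ∸ j) * n ^ j ≤ 400 ^ j * (V * V)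
  Vq-shrink-n² j j≤t = *-cancelʳ-≤ _ _ (n ^ j) ⦃ m^n≢0 n j ⦄ (begin
    W * W * n ^ j * n ^ j                    ≡⟨ regroup W (n ^ j) ⟩
    (W * n ^ j) * (W * n ^ j)                ≤⟨ *-mono-≤ (Vq-shrink-n j j≤t) (Vq-shrink-n j j≤t) ⟩
    ((2 * t) ^ j * V) * ((2 * t) ^ j * V)    ≡⟨ interchange ((2 * t) ^ j) V ⟩
    ((2 * t) ^ j * (2 * t) ^ j) * (V * V)    ≡⟨ cong (_* (V * V)) (^-distribʳ-* (2 * t) (2 * t) j) ⟨
    ((2 * t) * (2 * t)) ^ j * (V * V)        ≤⟨ *-monoˡ-≤ (V * V) (^-monoˡ-≤ j [2t]²≤400n) ⟩
    (400 * n) ^ j * (V * V)                  ≡⟨ cong (_* (V * V)) (^-distribʳ-* 400 n j) ⟩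
    400 ^ j * n ^ j * (V * V)                ≡⟨ swap (400 ^ j) (n ^ j) (V * V) ⟩
    400 ^ j * (V * V) * n ^ j                ∎)
    where
    open ≤-Reasoning
    W = Vq q n (t ∸ j)
    regroup : ∀ a b → a * a * b * b ≡ (a * b) * (a * b)
    regroup = solve-∀
    interchange : ∀ a b → (a * b) * (a * b) ≡ (a * a) * (b * b)
    interchange = solve-∀
    swap : ∀ a b c → a * b * c ≡ a * c * b
    swap = solve-∀

  near-bound : ∀ k deg a b → k ≤ 20 → deg * deg * (b * b) ≤ a * a * n ^ ceilHalf k →
               b * (overlapBound q n t k * deg) ≤ a * nearConstant q * V
  near-bound k deg a b k≤20 deg-small with k ≤ᵇ 2 * t in k≤2t
  ... | false = ≤-trans (≤-reflexive (*-zeroʳ b)) z≤n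
  ... | true  = m*m≤n*n⇒m≤n _ _ (begin
    b * ((q ^ k * W + 0) * deg) * (b * ((q ^ k * W + 0) * deg))   ≡⟨ regroup b (q ^ k) W deg ⟩
    deg * deg * (b * b) * ((q ^ k * q ^ k) * (W * W))             ≤⟨ *-monoˡ-≤ _ deg-small ⟩
    a * a * n ^ j * ((q ^ k * q ^ k) * (W * W))                   ≡⟨ regroup′ a (n ^ j) (q ^ k) W ⟩
    (a * a) * (q ^ k * q ^ k) * (W * W * n ^ j)                   ≤⟨ *-monoʳ-≤ ((a * a) * (q ^ k * q ^ k)) (Vq-shrink-n² j j≤t) ⟩
    (a * a) * (q ^ k * q ^ k) * (400 ^ j * (V * V))               ≡⟨ cong (λ x → (a * a) * (q ^ k * q ^ k) * (x * (V * V))) (^-distribʳ-* 20 20 j) ⟩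
    (a * a) * (q ^ k * q ^ k) * (20 ^ j * 20 ^ j * (V * V))       ≡⟨ square a (q ^ k) (20 ^ j) V ⟩
    (a * (q ^ k * 20 ^ j) * V) * (a * (q ^ k * 20 ^ j) * V)       ≤⟨ *-mono-≤ constant≤ constant≤ ⟩
    (a * nearConstant q * V) * (a * nearConstant q * V)           ∎)
    where
    open ≤-Reasoning
    j = ceilHalf k
    W = Vq q n (t ∸ j)
    j≤t : j ≤ t
    j≤t = ceilHalf≤ (≤ᵇ⇒≤ k (2 * t) (≡true⇒T k≤2t))
    constant≤ : a * (q ^ k * 20 ^ j) * V ≤ a * nearConstant q * V
    constant≤ = *-monoˡ-≤ V (*-monoʳ-≤ a (*-mono-≤ (^-monoʳ-≤ q k≤20) (^-monoʳ-≤ 20 (ceilHalf≤ {t = 10} k≤20))))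
    regroup : ∀ b Q W d → b * ((Q * W + 0) * d) * (b * ((Q * W + 0) * d)) ≡ d * d * (b * b) * ((Q * Q) * (W * W))
    regroup = solve-∀
    regroup′ : ∀ a N Q W → a * a * N * ((Q * Q) * (W * W)) ≡ (a * a) * (Q * Q) * (W * W * N)
    regroup′ = solve-∀
    square : ∀ a Q T V → (a * a) * (Q * Q) * (T * T * (V * V)) ≡ (a * (Q * T) * V) * (a * (Q * T) * V)
    square = solve-∀

  -- q^d ≤ (q²)^⌈d/2⌉ and V_q(n, t − j) ≤ (2t/n)^j V, so the overlap is at most (Z/n)^⌈d/2⌉ V ≤ (Z/n)^11 V.
  far-bound : ∀ d → 21 ≤ d → d ≤ 2 * t → n ^ 11 * (q ^ d * Vq q n (t ∸ ceilHalf d)) ≤ Z ^ 11 * V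
  far-bound d 21≤d d≤2t = *-cancelʳ-≤ _ _ (n ^ e) ⦃ m^n≢0 n e ⦄ (begin
    n ^ 11 * (q ^ d * W) * n ^ e          ≡⟨ regroup (n ^ 11) (q ^ d) W (n ^ e) ⟩
    q ^ d * (W * (n ^ 11 * n ^ e))        ≡⟨ cong (λ x → q ^ d * (W * x)) (trans (sym (^-distribˡ-+-* n 11 e)) (cong (n ^_) 11+e≡j)) ⟩
    q ^ d * (W * n ^ j)                   ≤⟨ *-mono-≤ q^d≤ (Vq-shrink-n j j≤t) ⟩
    (q * q) ^ j * ((2 * t) ^ j * V)       ≡⟨ *-assoc ((q * q) ^ j) ((2 * t) ^ j) V ⟨
    (q * q) ^ j * (2 * t) ^ j * V         ≡⟨ cong (_* V) (trans (*-comm ((q * q) ^ j) ((2 * t) ^ j)) (sym (^-distribʳ-* (2 * t) (q * q) j))) ⟩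
    Z ^ j * V                             ≡⟨ cong (λ x → Z ^ x * V) 11+e≡j ⟨
    Z ^ (11 + e) * V                      ≡⟨ cong (_* V) (^-distribˡ-+-* Z 11 e) ⟩
    Z ^ 11 * Z ^ e * V                    ≤⟨ *-monoˡ-≤ V (*-monoʳ-≤ (Z ^ 11) (^-monoˡ-≤ e Z≤n)) ⟩
    Z ^ 11 * n ^ e * V                    ≡⟨ swap (Z ^ 11) (n ^ e) V ⟩
    Z ^ 11 * V * n ^ e                    ∎)
    where
    open ≤-Reasoning
    j = ceilHalf d
    W = Vq q n (t ∸ j)
    j≤t : j ≤ t
    j≤t = ceilHalf≤ d≤2t
    e = j ∸ 11
    11+e≡j : 11 + e ≡ j
    11+e≡j = m+[n∸m]≡n (11≤ceilHalf 21≤d)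
    q^d≤ : q ^ d ≤ (q * q) ^ j
    q^d≤ = ≤-trans (^-monoʳ-≤ q (≤ceilHalf*2 d))
             (≤-reflexive (trans (cong (q ^_) (*-comm j 2)) (trans (sym (^-*-assoc q 2 j)) (cong (_^ j) (cong (q *_) (*-identityʳ q))))))
    regroup : ∀ N Q W E → N * (Q * W) * E ≡ Q * (W * (N * E))
    regroup = solve-∀
    swap : ∀ a b c → a * b * c ≡ a * c * b
    swap = solve-∀

  farOverlap≤ : (S : Vec (Fin q) n → Bool) (u v : Vec (Fin q) n) →
    n ^ 11 * farOverlap q n t S u v ≤ 𝟙 (S v ∧ not (ham v u ≡ᵇ 0) ∧ (ham v u ≤ᵇ 2 * t)) * (Z ^ 11 * V)
  farOverlap≤ S u v with S v | 21 ≤ᵇ ham v u in far | ham v u ≤ᵇ 2 * t in close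
  ... | false | _     | _     = ≤-reflexive (*-zeroʳ (n ^ 11))
  ... | true  | false | _     = ≤-trans (≤-reflexive (*-zeroʳ (n ^ 11))) z≤n
  ... | true  | true  | false = ≤-trans (≤-reflexive (*-zeroʳ (n ^ 11))) z≤n
  ... | true  | true  | true rewrite 0<d⇒≡ᵇ0-false (≤-trans (s≤s z≤n) (≤ᵇ⇒≤ 21 (ham v u) (≡true⇒T far))) = begin
    n ^ 11 * (1 * (1 * (1 * X)))  ≡⟨ cong (n ^ 11 *_) (trans (*-identityˡ _) (trans (*-identityˡ _) (*-identityˡ X))) ⟩
    n ^ 11 * X                ≤⟨ far-bound (ham v u) 21≤d (≤ᵇ⇒≤ (ham v u) (2 * t) (≡true⇒T close)) ⟩
    Z ^ 11 * V                ≡⟨ *-identityˡ _ ⟨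
    1 * (Z ^ 11 * V)          ∎
    where
    open ≤-Reasoning
    X = q ^ ham v u * Vq q n (t ∸ ceilHalf (ham v u))
    21≤d : 21 ≤ ham v u
    21≤d = ≤ᵇ⇒≤ 21 (ham v u) (≡true⇒T far)

  ∑farOverlap≤ : (S : Vec (Fin q) n → Bool) (u : Vec (Fin q) n) →
    n ^ 11 * ∑[ v ∈ words q n ] farOverlap q n t S u v ≤ degG q n t S u * (Z ^ 11 * V)
  ∑farOverlap≤ S u = begin
    n ^ 11 * ∑[ v ∈ W ] farOverlap q n t S u v            ≡⟨ ∑-*ˡ W (n ^ 11) _ ⟨
    ∑[ v ∈ W ] (n ^ 11 * farOverlap q n t S u v)          ≤⟨ ∑-mono-≤ W (farOverlap≤ S u) ⟩
    ∑[ v ∈ W ] (𝟙 (close v) * Y)                          ≡⟨ ∑-cong W (λ v → *-comm _ Y) ⟩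
    ∑[ v ∈ W ] (Y * 𝟙 (close v))                          ≡⟨ ∑-*ˡ W Y _ ⟩
    Y * ∑[ v ∈ W ] 𝟙 (close v)                            ≡⟨ cong (Y *_) (count≡∑ q n close) ⟨
    Y * degG q n t S u                                    ≡⟨ *-comm Y _ ⟩
    degG q n t S u * Y                                    ∎
    where
    open ≤-Reasoning
    W = words q n
    Y = Z ^ 11 * V
    close : Vec (Fin q) n → Bool
    close v = S v ∧ not (ham v u ≡ᵇ 0) ∧ (ham v u ≤ᵇ 2 * t)

  -- The far overlaps total at most n^5 · (Z/n)^11 V ≤ (400q⁴)^{11/2} n^{-1/2} V, which is at most V/b once n ≥ b² (400q⁴)^11.
  ∑farOverlap≤aV : (S : Vec (Fin q) n → Bool) (u : Vec (Fin q) n) (a b : ℕ) → degG q n t S u ≤ n ^ 5 →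
    b * b * farConstant q ≤ n → 1 ≤ a → b * ∑[ v ∈ words q n ] farOverlap q n t S u v ≤ a * V
  ∑farOverlap≤aV S u a b deg≤n⁵ b²M≤n 1≤a = m*m≤n*n⇒m≤n _ _ (*-cancelʳ-≤ _ _ n (begin
    b * F * (b * F) * n             ≤⟨ squared ⟩
    b * b * M * (V * V)             ≤⟨ *-monoˡ-≤ (V * V) b²M≤n ⟩
    n * (V * V)                     ≤⟨ *-monoʳ-≤ n (*-mono-≤ (m≤n*m V a ⦃ ℕ.>-nonZero 1≤a ⦄) (m≤n*m V a ⦃ ℕ.>-nonZero 1≤a ⦄)) ⟩
    n * (a * V * (a * V))           ≡⟨ *-comm n _ ⟩
    a * V * (a * V) * n             ∎))
    where
    open ≤-Reasoning
    F = ∑[ v ∈ words q n ] farOverlap q n t S u v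
    Y = Z ^ 11 * V
    M = farConstant q
    n⁶F≤Y : n ^ 6 * F ≤ Y
    n⁶F≤Y = *-cancelˡ-≤ (n ^ 5) ⦃ m^n≢0 n 5 ⦄ (begin
      n ^ 5 * (n ^ 6 * F)     ≡⟨ *-assoc (n ^ 5) (n ^ 6) F ⟨
      n ^ 5 * n ^ 6 * F       ≡⟨ cong (_* F) (^-distribˡ-+-* n 5 6) ⟨
      n ^ 11 * F              ≤⟨ ∑farOverlap≤ S u ⟩
      degG q n t S u * Y      ≤⟨ *-monoˡ-≤ Y deg≤n⁵ ⟩
      n ^ 5 * Y               ∎)
    n¹¹*n≡n⁶*n⁶ : n ^ 11 * n ≡ n ^ 6 * n ^ 6
    n¹¹*n≡n⁶*n⁶ = trans (cong (n ^ 11 *_) (sym (*-identityʳ n)))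
                        (trans (sym (^-distribˡ-+-* n 11 1)) (^-distribˡ-+-* n 6 6))
    squared : b * F * (b * F) * n ≤ b * b * M * (V * V)
    squared = *-cancelʳ-≤ _ _ (n ^ 11) ⦃ m^n≢0 n 11 ⦄ (begin
      b * F * (b * F) * n * n ^ 11                 ≡⟨ regroup b F n (n ^ 11) ⟩
      b * b * (F * F) * (n ^ 11 * n)               ≡⟨ cong (λ x → b * b * (F * F) * x) n¹¹*n≡n⁶*n⁶ ⟩
      b * b * (F * F) * (n ^ 6 * n ^ 6)            ≡⟨ regroup′ b F (n ^ 6) ⟩
      b * b * ((n ^ 6 * F) * (n ^ 6 * F))          ≤⟨ *-monoʳ-≤ (b * b) (*-mono-≤ n⁶F≤Y n⁶F≤Y) ⟩
      b * b * (Y * Y)                              ≡⟨ cong (b * b *_) (interchange (Z ^ 11) V) ⟩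
      b * b * ((Z ^ 11 * Z ^ 11) * (V * V))        ≡⟨ cong (λ x → b * b * (x * (V * V))) (^-distribʳ-* Z Z 11) ⟨
      b * b * ((Z * Z) ^ 11 * (V * V))             ≤⟨ *-monoʳ-≤ (b * b) (*-monoˡ-≤ (V * V) (^-monoˡ-≤ 11 Z²≤400q⁴n)) ⟩
      b * b * (((400 * q ^ 4) * n) ^ 11 * (V * V)) ≡⟨ cong (λ x → b * b * (x * (V * V))) (^-distribʳ-* (400 * q ^ 4) n 11) ⟩
      b * b * (M * n ^ 11 * (V * V))               ≡⟨ regroup″ (b * b) M (n ^ 11) (V * V) ⟩
      b * b * M * (V * V) * n ^ 11                 ∎)
      where
      regroup : ∀ b F n N → b * F * (b * F) * n * N ≡ b * b * (F * F) * (N * n)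
      regroup = solve-∀
      regroup′ : ∀ b F N → b * b * (F * F) * (N * N) ≡ b * b * ((N * F) * (N * F))
      regroup′ = solve-∀
      interchange : ∀ A V → A * V * (A * V) ≡ (A * A) * (V * V)
      interchange = solve-∀
      regroup″ : ∀ B M N W → B * (M * N * W) ≡ B * M * W * N
      regroup″ = solve-∀

  ballOverlaps≤aKV : (S T : Vec (Fin q) n → Bool) → (∀ v → T v ≡ true → S v ≡ true) →
    (u : Vec (Fin q) n) (a b : ℕ) →
    All (λ k → degk q n S u k * degk q n S u k * (b * b) ≤ a * a * n ^ ceilHalf k) smallDistances →
    degG q n t S u ≤ n ^ 5 → b * b * farConstant q ≤ n → 1 ≤ a →
    b * ballOverlaps t T u ≤ a * degreeConstant q * V
  ballOverlaps≤aKV S T T⊆S u a b degk-small deg≤n⁵ b²M≤n 1≤a = begin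
    b * ballOverlaps t T u                               ≤⟨ *-monoʳ-≤ b (ballOverlaps≤ q n t S T T⊆S u) ⟩
    b * (∑ smallDistances near + F)                      ≡⟨ *-distribˡ-+ b _ F ⟩
    b * ∑ smallDistances near + b * F                    ≡⟨ cong (_+ b * F) (∑-*ˡ smallDistances b near) ⟨
    ∑[ k ∈ smallDistances ] (b * near k) + b * F         ≤⟨ +-mono-≤ (∑-≤-const smallDistances _ each-near) (∑farOverlap≤aV S u a b deg≤n⁵ b²M≤n 1≤a) ⟩
    20 * (a * nearConstant q * V) + a * V                ≡⟨ collect a (nearConstant q) V ⟩
    a * degreeConstant q * V                             ∎
    where
    open ≤-Reasoning
    near : ℕ → ℕ
    near k = overlapBound q n t k * degk q n S u k
    F = ∑[ v ∈ words q n ] farOverlap q n t S u v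
    each-near : All (λ k → b * near k ≤ a * nearConstant q * V) smallDistances
    each-near = All.zipWith (λ (k≤20 , small) → near-bound _ _ a b k≤20 small) (smallDistances≤20 , degk-small)
    collect : ∀ a C V → 20 * (a * C * V) + a * V ≡ a * suc (20 * C) * V
    collect = solve-∀

count*Vq≤-from-vertex-bound : (q n t b X : ℕ) (T : Vec (Fin q) n → Bool) →
  (∀ u → T u ≡ true → b * ballOverlaps t T u ≤ X) →
  b * (count q n T * Vq q n t) ≤ b * q ^ n + count q n T * X
count*Vq≤-from-vertex-bound q n t b X T vertex-bound = begin
  b * (count q n T * Vq q n t)                          ≤⟨ *-monoʳ-≤ b (count*Vq≤ q n t T) ⟩
  b * (q ^ n + ∑[ u ∈ W ] (𝟙 (T u) * ballOverlaps t T u))  ≡⟨ *-distribˡ-+ b _ _ ⟩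
  b * q ^ n + b * ∑[ u ∈ W ] (𝟙 (T u) * ballOverlaps t T u) ≡⟨ cong (b * q ^ n +_) (∑-*ˡ W b _) ⟨
  b * q ^ n + ∑[ u ∈ W ] (b * (𝟙 (T u) * ballOverlaps t T u)) ≤⟨ +-monoʳ-≤ (b * q ^ n) (∑-mono-≤ W pointwise) ⟩
  b * q ^ n + ∑[ u ∈ W ] (X * 𝟙 (T u))                  ≡⟨ cong (b * q ^ n +_) (∑-*ˡ W X _) ⟩
  b * q ^ n + X * ∑[ u ∈ W ] 𝟙 (T u)                    ≡⟨ cong (λ c → b * q ^ n + X * c) (count≡∑ q n T) ⟨
  b * q ^ n + X * count q n T                           ≡⟨ cong (b * q ^ n +_) (*-comm X _) ⟩
  b * q ^ n + count q n T * X                           ∎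
  where
  open ≤-Reasoning
  W = words q n
  pointwise : ∀ u → b * (𝟙 (T u) * ballOverlaps t T u) ≤ X * 𝟙 (T u)
  pointwise u with T u in Tu
  ... | false = ≤-reflexive (trans (*-zeroʳ b) (sym (*-zeroʳ X)))
  ... | true  = ≤-trans (≤-reflexive (cong (b *_) (+-identityʳ _)))
                        (≤-trans (vertex-bound u Tu) (≤-reflexive (sym (*-identityʳ X))))

-- With b = c + 2p the hypothesis reads (c + p) X ≤ (c + 2p) Q, and (c + 2p)² ≤ (c + 4p)(c + p).
b*X≤b*Q+p*X⇒b*X≤[b+2p]*Q : ∀ b p X Q → 1 ≤ b → 2 * p ≤ b → b * X ≤ b * Q + p * X → b * X ≤ (b + 2 * p) * Q
b*X≤b*Q+p*X⇒b*X≤[b+2p]*Q b p X Q 1≤b 2p≤b h =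
  subst (λ b → b * X ≤ (b + 2 * p) * Q) (m∸n+n≡m 2p≤b) (*-cancelʳ-≤ _ _ (c + p) ⦃ ℕ.>-nonZero 1≤c+p ⦄ (begin
    (c + 2 * p) * X * (c + p)               ≡⟨ regroup c p X ⟩
    (c + 2 * p) * ((c + p) * X)             ≤⟨ *-monoʳ-≤ (c + 2 * p) [c+p]X≤ ⟩
    (c + 2 * p) * ((c + 2 * p) * Q)         ≡⟨ *-assoc (c + 2 * p) _ Q ⟨
    ((c + 2 * p) * (c + 2 * p)) * Q         ≤⟨ *-monoˡ-≤ Q (m≤m+n ((c + 2 * p) * (c + 2 * p)) (c * p)) ⟩
    ((c + 2 * p) * (c + 2 * p) + c * p) * Q ≡⟨ expand c p Q ⟩
    (c + 2 * p + 2 * p) * Q * (c + p)       ∎))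
  where
  open ≤-Reasoning
  c = b ∸ 2 * p
  b≡c+2p : b ≡ c + 2 * p
  b≡c+2p = sym (m∸n+n≡m 2p≤b)
  1≤c+p : 1 ≤ c + p
  1≤c+p = positive c p (subst (1 ≤_) b≡c+2p 1≤b)
    where
    positive : ∀ c p → 1 ≤ c + 2 * p → 1 ≤ c + p
    positive (suc c) p       _  = s≤s z≤n
    positive zero    (suc p) _  = s≤s z≤n
    positive zero    zero    ()
  [c+p]X≤ : (c + p) * X ≤ (c + 2 * p) * Q
  [c+p]X≤ = +-cancelʳ-≤ (p * X) _ _ (≤-trans (≤-reflexive (split c p X)) (subst (λ b → b * X ≤ b * Q + p * X) b≡c+2p h))
    where
    split : ∀ c p X → (c + p) * X + p * X ≡ (c + 2 * p) * X
    split = solve-∀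
  regroup : ∀ c p X → (c + 2 * p) * X * (c + p) ≡ (c + 2 * p) * ((c + p) * X)
  regroup = solve-∀
  expand : ∀ c p Q → ((c + 2 * p) * (c + 2 * p) + c * p) * Q ≡ (c + 2 * p + 2 * p) * Q * (c + p)
  expand = solve-∀

count-bound : (q n t a b : ℕ) (S T : Vec (Fin q) n → Bool) →
  2 ≤ q → t * t ≤ 100 * n → 400 * q ^ 4 ≤ n → b * b * farConstant q ≤ n → 1 ≤ a →
  2 * (a * degreeConstant q) ≤ b → MaxDegLE q n t S (n ^ 5) → (∀ u → T u ≡ true → S u ≡ true) →
  (∀ u → T u ≡ true → All (λ k → degk q n S u k * degk q n S u k * (b * b) ≤ a * a * n ^ ceilHalf k) smallDistances) →
  b * (count q n T * Vq q n t) ≤ (b + 2 * (a * degreeConstant q)) * q ^ n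
count-bound q n t a b S T 2≤q t²≤100n 400q⁴≤n b²M≤n 1≤a 2aK≤b maxDeg T⊆S degk-small =
  b*X≤b*Q+p*X⇒b*X≤[b+2p]*Q b p N*V (q ^ n) 1≤b 2aK≤b (begin
    b * N*V                           ≤⟨ count*Vq≤-from-vertex-bound q n t b (p * Vq q n t) T vertex-bound ⟩
    b * q ^ n + count q n T * (p * Vq q n t) ≡⟨ cong (b * q ^ n +_) (swap (count q n T) p (Vq q n t)) ⟩
    b * q ^ n + p * N*V               ∎)
  where
  open ≤-Reasoning
  open LargeDimension q n t 2≤q t²≤100n 400q⁴≤n
  p = a * degreeConstant q
  N*V = count q n T * Vq q n t
  1≤b : 1 ≤ b
  1≤b = ≤-trans 1≤a (≤-trans (m≤m*n a (degreeConstant q)) (≤-trans (m≤n*m p 2) 2aK≤b))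
  vertex-bound : ∀ u → T u ≡ true → b * ballOverlaps t T u ≤ p * Vq q n t
  vertex-bound u Tu = ballOverlaps≤aKV S T T⊆S u a b (degk-small u Tu) (maxDeg u (T⊆S u Tu)) b²M≤n 1≤a
  swap : ∀ N p V → N * (p * V) ≡ p * (N * V)
  swap = solve-∀

-- Clearing denominators

infix 4 _≈_/1+_

_≈_/1+_ : ℚ → ℕ → ℕ → Set
p ≈ x /1+ D = toℚᵘ p ℚᵘ.≃ mkℚᵘ (+ℤ x) D

fromℚᵘ-≈ : ∀ x D → fromℚᵘ (mkℚᵘ (+ℤ x) D) ≈ x /1+ D
fromℚᵘ-≈ x D = ℚP.toℚᵘ-fromℚᵘ (mkℚᵘ (+ℤ x) D)

ℕtoℚ-≈ : ∀ m → ℕtoℚ m ≈ m /1+ 0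
ℕtoℚ-≈ m = fromℚᵘ-≈ m 0

Hq-≈ : ∀ q n t → Hq q n t ≈ q ^ n /1+ (Vq q n t ∸ 1)
Hq-≈ q n t = ℚᵘP.≃-trans (ℚP.toℚᵘ-cong (ℚP./-cong {+ℤ q ^ n} {Vq q n t} {+ℤ q ^ n} {suc (Vq q n t ∸ 1)}
                            ⦃ Vq-nonZero q n t ⦄ ⦃ _ ⦄ refl V≡suc))
                          (fromℚᵘ-≈ (q ^ n) (Vq q n t ∸ 1))
  where
  V≡suc : Vq q n t ≡ suc (Vq q n t ∸ 1)
  V≡suc = sym (trans (+-comm 1 _) (m∸n+n≡m (Vq≥1 q n t)))

module _ {p p′ : ℚ} {x x′ D D′ : ℕ} (p≈ : p ≈ x /1+ D) (p′≈ : p′ ≈ x′ /1+ D′) where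

  *-≈ : p ℚ.* p′ ≈ x * x′ /1+ (D′ + D * suc D′)
  *-≈ = ℚᵘP.≃-trans (ℚP.toℚᵘ-homo-* p p′) (ℚᵘP.≃-trans (ℚᵘP.*-cong p≈ p′≈)
          (ℚᵘP.≃-reflexive (cong (λ z → mkℚᵘ z (D′ + D * suc D′)) (sym (ℤP.pos-* x x′)))))

  +-≈ : p ℚ.+ p′ ≈ x * suc D′ + x′ * suc D /1+ (D′ + D * suc D′)
  +-≈ = ℚᵘP.≃-trans (ℚP.toℚᵘ-homo-+ p p′) (ℚᵘP.≃-trans (ℚᵘP.+-cong p≈ p′≈)
          (ℚᵘP.≃-reflexive (cong (λ z → mkℚᵘ z (D′ + D * suc D′))
            (trans (cong₂ ℤ._+_ (sym (ℤP.pos-* x (suc D′))) (sym (ℤP.pos-* x′ (suc D))))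
                   (sym (ℤP.pos-+ (x * suc D′) (x′ * suc D)))))))

  ≤-≈⁻ : p ℚ.≤ p′ → x * suc D′ ≤ x′ * suc D
  ≤-≈⁻ p≤p′ with ℚᵘP.≤-respʳ-≃ p′≈ (ℚᵘP.≤-respˡ-≃ p≈ (ℚP.toℚᵘ-mono-≤ p≤p′))
  ... | *≤* h rewrite sym (ℤP.pos-* x (suc D′)) | sym (ℤP.pos-* x′ (suc D)) = ℤP.drop‿+≤+ h

  ≤-≈ : x * suc D′ ≤ x′ * suc D → p ℚ.≤ p′
  ≤-≈ le = ℚP.toℚᵘ-cancel-≤ (ℚᵘP.≤-respʳ-≃ (ℚᵘP.≃-sym p′≈) (ℚᵘP.≤-respˡ-≃ (ℚᵘP.≃-sym p≈)
             (*≤* (subst₂ ℤ._≤_ (ℤP.pos-* x (suc D′)) (ℤP.pos-* x′ (suc D)) (ℤ.+≤+ le)))))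

  <-≈ : x * suc D′ < x′ * suc D → p ℚ.< p′
  <-≈ lt = ℚP.toℚᵘ-cancel-< (ℚᵘP.<-respʳ-≃ (ℚᵘP.≃-sym p′≈) (ℚᵘP.<-respˡ-≃ (ℚᵘP.≃-sym p≈)
             (*<* (subst₂ ℤ._<_ (ℤP.pos-* x (suc D′)) (ℤP.pos-* x′ (suc D)) (ℤ.+<+ lt)))))

positive-≈ : (ε : ℚ) → 0ℚ ℚ.< ε → Σ ℕ λ a → Σ ℕ λ D → ε ≈ suc a /1+ D
positive-≈ (mkℚ (+ℤ 0)     D _) (ℚ.*<* (ℤ.+<+ ()))
positive-≈ (mkℚ -[1+ _ ]   D _) (ℚ.*<* ())
positive-≈ (mkℚ (+ℤ suc a) D _) _ = a , D , ℚᵘP.≃-refl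

module _ {ε : ℚ} {a D : ℕ} (ε≈ : ε ≈ a /1+ D) where

  ε≤1/[1+2K]⇒ : ∀ K → ε ℚ.≤ fromℚᵘ (mkℚᵘ (+ℤ 1) (2 * K)) → 2 * (a * K) ≤ suc D
  ε≤1/[1+2K]⇒ K ε≤ = begin
    2 * (a * K)        ≤⟨ m≤n+m _ a ⟩
    a + 2 * (a * K)    ≡⟨ expand a K ⟩
    a * suc (2 * K)    ≤⟨ ≤-≈⁻ ε≈ (fromℚᵘ-≈ 1 (2 * K)) ε≤ ⟩
    1 * suc D          ≡⟨ *-identityˡ (suc D) ⟩
    suc D              ∎
    where
    open ≤-Reasoning
    expand : ∀ a K → a + 2 * (a * K) ≡ a * suc (2 * K)
    expand = solve-∀

  degOK⇒ : ∀ n d k → degOK ε n d k ≡ true → d * d * (suc D * suc D) ≤ a * a * n ^ ceilHalf k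
  degOK⇒ n d k ok = ≤-trans (≤-reflexive (denominator (d * d) D))
    (≤-trans (≤-≈⁻ (ℕtoℚ-≈ (d * d)) (*-≈ (*-≈ ε≈ ε≈) (ℕtoℚ-≈ (n ^ ceilHalf k))) (ℚP.≤ᵇ⇒≤ (≡true⇒T ok)))
             (≤-reflexive (*-identityʳ _)))
    where
    denominator : ∀ X D → X * (suc D * suc D) ≡ X * suc (0 + (D + D * suc D) * suc 0)
    denominator = solve-∀

  S1⇒degk-small : ∀ q n S u → S1 q n ε S u ≡ true →
    All (λ k → degk q n S u k * degk q n S u k * (suc D * suc D) ≤ a * a * n ^ ceilHalf k) smallDistances
  S1⇒degk-small q n S u u∈S1 = All.map (λ {k} → degOK⇒ n (degk q n S u k) k) (allᵇ⇒All smallDistances _ (∧≡true⇒ʳ {S u} u∈S1))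

  count-bound-ℚ : ∀ K q n t N → suc D * (N * Vq q n t) ≤ (suc D + 2 * (a * K)) * q ^ n →
    ℕtoℚ N ℚ.≤ (1ℚ ℚ.+ ℕtoℚ (2 * K) ℚ.* ε) ℚ.* Hq q n t
  count-bound-ℚ K q n t N h = ≤-≈ (ℕtoℚ-≈ N) (*-≈ (+-≈ (ℕtoℚ-≈ 1) (*-≈ (ℕtoℚ-≈ (2 * K)) ε≈)) (Hq-≈ q n t))
    (≤-trans (≤-reflexive (trans (lhs N D V′) (cong (λ v → suc D * (N * v))
                                               (trans (+-comm 1 V′) (m∸n+n≡m (Vq≥1 q n t))))))
             (≤-trans h (≤-reflexive (rhs D a K (q ^ n)))))
    where
    V′ = Vq q n t ∸ 1
    lhs : ∀ N D V′ → N * suc (V′ + (D + 0 + 0) * suc V′) ≡ suc D * (N * suc V′)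
    lhs = solve-∀
    rhs : ∀ D a K Q → (suc D + 2 * (a * K)) * Q ≡ (1 * suc (D + 0) + 2 * K * a * 1) * Q * 1
    rhs = solve-∀

lemma4p2 : (q : ℕ) → 2 ≤ q →
    Σ ℚ λ K → Σ ℚ λ ε₀ → (0ℚ ℚ.< K) × (0ℚ ℚ.< ε₀) ×
      ((ε : ℚ) → 0ℚ ℚ.< ε → ε ℚ.≤ ε₀ →
        Σ ℕ λ n₀ → (n : ℕ) → n₀ ≤ n → (t : ℕ) → 1 ≤ t → t * t ≤ 100 * n →
          (S : Vec (Fin q) n → Bool) → MaxDegLE q n t S (n ^ 5) →
          ℕtoℚ (count q n (S1 q n ε S)) ℚ.≤ (1ℚ ℚ.+ K ℚ.* ε) ℚ.* Hq q n t)
lemma4p2 q 2≤q = ℕtoℚ (2 * K₀) , ε₀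
                , <-≈ (ℕtoℚ-≈ 0) (ℕtoℚ-≈ (2 * K₀)) (s≤s z≤n) , <-≈ (ℕtoℚ-≈ 0) (fromℚᵘ-≈ 1 (2 * K₀)) (s≤s z≤n)
                , λ ε 0<ε → for-fraction (positive-≈ ε 0<ε)
  where
  K₀ : ℕ
  K₀ = degreeConstant q
  ε₀ : ℚ
  ε₀ = fromℚᵘ (mkℚᵘ (+ℤ 1) (2 * K₀))
  for-fraction : ∀ {ε} → (Σ ℕ λ a → Σ ℕ λ D → ε ≈ suc a /1+ D) → ε ℚ.≤ ε₀ →
    Σ ℕ λ n₀ → (n : ℕ) → n₀ ≤ n → (t : ℕ) → 1 ≤ t → t * t ≤ 100 * n →
      (S : Vec (Fin q) n → Bool) → MaxDegLE q n t S (n ^ 5) →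
      ℕtoℚ (count q n (S1 q n ε S)) ℚ.≤ (1ℚ ℚ.+ ℕtoℚ (2 * K₀) ℚ.* ε) ℚ.* Hq q n t
  for-fraction {ε} (a , D , ε≈) ε≤ε₀ = 400 * q ^ 4 + suc D * suc D * farConstant q , λ n n₀≤n t _ t²≤100n S maxDeg →
    count-bound-ℚ ε≈ K₀ q n t (count q n (S1 q n ε S))
      (count-bound q n t (suc a) (suc D) S (S1 q n ε S) 2≤q t²≤100n
         (≤-trans (m≤m+n (400 * q ^ 4) (suc D * suc D * farConstant q)) n₀≤n)
         (≤-trans (m≤n+m (suc D * suc D * farConstant q) (400 * q ^ 4)) n₀≤n) (s≤s z≤n)
         (ε≤1/[1+2K]⇒ ε≈ K₀ ε≤ε₀) maxDeg (λ u → ∧≡true⇒ˡ) (S1⇒degk-small ε≈ q n S))
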